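{- Let $n\ge2$, $m\ge0$, $j\in\{2,\dots,n\}$, and for integers $k\ge0$ let $Q^{k,m}=\int_{x_1}^{x_j}t^k\prod_{i=1}^n(t-x_i)^m\,dt$. Let $$L_m=\sum_{i=1}^n\frac{\partial^2}{\partial x_i^2}-2m\sum_{1\le i<l\le n}\frac{1}{x_i-x_l}\left(\frac{\partial}{\partial x_i}-\frac{\partial}{\partial x_l}\right).$$ Then $L_m(Q^{k,m})=k(k-1)Q^{k-2,m}$ for $k\ge2$, and $L_m(Q^{k,m})=0$ for $k=0,1$.
   Context: $Q^{k,m}$ is the polynomial $Q_T^{k,m}$ associated with the standard tableau $T$ of shape $[n-1,1]$ whose second-row entry is $j$. -}

module Defs where

open import Data.Nat as ℕ using (ℕ; zero; suc)
open import Data.Fin as F using (Fin)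
open import Data.List using (List; []; _∷_)
open import Data.Integer using (+_)
open import Data.Rational as Q using (ℚ; 0ℚ; 1ℚ; _/_; ≢-nonZero; 1/_)
open import Data.Rational.Properties using (_≟_)
open import Relation.Nullary using (yes; no; does)
open import Data.Bool using (if_then_else_)

ℕ→ℚ : ℕ → ℚ
ℕ→ℚ k = + k / 1

-- total inverse on ℚ (inv 0 = 0); only ever applied to nonzero arguments below
inv : ℚ → ℚ
inv p with p ≟ 0ℚ
... | yes _ = 0ℚ
... | no p≢0 = 1/_ p {{≢-nonZero p≢0}}

-- Formal polynomial expressions in the variables x_0 … x_{n-1} over ℚ
-- (variable x_i of the paper is index i-1).
data Expr (n : ℕ) : Set where
  var  : Fin n → Expr n
  con  : ℚ → Expr n
  _⊕_  : Expr n → Expr n → Expr n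
  _⊗_  : Expr n → Expr n → Expr n

_⊖_ : ∀ {n} → Expr n → Expr n → Expr n
a ⊖ b = a ⊕ (con (Q.- 1ℚ) ⊗ b)

eval : ∀ {n} → (Fin n → ℚ) → Expr n → ℚ
eval x (var i) = x i
eval x (con c) = c
eval x (a ⊕ b) = eval x a Q.+ eval x b
eval x (a ⊗ b) = eval x a Q.* eval x b

∂ : ∀ {n} → Fin n → Expr n → Expr n
∂ i (var l) = if does (i F.≟ l) then con 1ℚ else con 0ℚ
∂ i (con c) = con 0ℚ
∂ i (a ⊕ b) = ∂ i a ⊕ ∂ i b
∂ i (a ⊗ b) = (∂ i a ⊗ b) ⊕ (a ⊗ ∂ i b)

-- Polynomials in an auxiliary variable t with Expr coefficients,
-- coefficient lists in ascending degree.
TPoly : ℕ → Set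
TPoly n = List (Expr n)

addT : ∀ {n} → TPoly n → TPoly n → TPoly n
addT [] q = q
addT (a ∷ p) [] = a ∷ p
addT (a ∷ p) (b ∷ q) = (a ⊕ b) ∷ addT p q

scaleT : ∀ {n} → Expr n → TPoly n → TPoly n
scaleT c [] = []
scaleT c (a ∷ p) = (c ⊗ a) ∷ scaleT c p

mulT : ∀ {n} → TPoly n → TPoly n → TPoly n
mulT [] q = []
mulT (a ∷ p) q = addT (scaleT a q) (con 0ℚ ∷ mulT p q)

powT : ∀ {n} → TPoly n → ℕ → TPoly n
powT p zero = con 1ℚ ∷ []
powT p (suc m) = mulT p (powT p m)

tPow : ∀ {n} → ℕ → TPoly n
tPow zero = con 1ℚ ∷ []
tPow (suc k) = con 0ℚ ∷ tPow k

prodT : ∀ {n} (N : ℕ) → (Fin N → TPoly n) → TPoly n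
prodT zero f = con 1ℚ ∷ []
prodT (suc N) f = mulT (f F.zero) (prodT N (λ i → f (F.suc i)))

antiderivFrom : ∀ {n} → ℕ → TPoly n → TPoly n
antiderivFrom d [] = []
antiderivFrom d (a ∷ p) = (con (+ 1 / suc d) ⊗ a) ∷ antiderivFrom (suc d) p

antideriv : ∀ {n} → TPoly n → TPoly n
antideriv p = con 0ℚ ∷ antiderivFrom 0 p

substT : ∀ {n} → TPoly n → Expr n → Expr n
substT [] e = con 0ℚ
substT (a ∷ p) e = a ⊕ (e ⊗ substT p e)

integrand : (n k m : ℕ) → TPoly n
integrand n k m = mulT (tPow k) (prodT n (λ i → powT (con (Q.- 1ℚ) ⊗ var i ∷ con 1ℚ ∷ []) m))

-- Q^{k,m} = ∫_{x_a}^{x_b} t^k ∏ (t - x_i)^m dt, as a polynomial expression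
-- (in the paper a = x_1, b = x_j)
Qkm : (n : ℕ) → (a b : Fin n) → (k m : ℕ) → Expr n
Qkm n a b k m = substT F (var b) ⊖ substT F (var a)
  where F = antideriv (integrand n k m)

sumFin : (N : ℕ) → (Fin N → ℚ) → ℚ
sumFin zero f = 0ℚ
sumFin (suc N) f = f F.zero Q.+ sumFin N (λ i → f (F.suc i))

Lm : (n m : ℕ) → Expr n → (Fin n → ℚ) → ℚ
Lm n m P x =
  sumFin n (λ i → eval x (∂ i (∂ i P)))
  Q.- (ℕ→ℚ (2 ℕ.* m) Q.* sumFin n (λ i → sumFin n (λ l →
        if does (i F.<? l)
        then inv (x i Q.- x l) Q.* (eval x (∂ i P) Q.- eval x (∂ l P))
        else 0ℚ)))

-- Write P(t) = ∏ₗ (t − xₗ)ᵐ. Differentiating under the integral sign, with moving endpoints,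
-- L_m Q^{k,m} is the integral of L_m(tᵏP) plus boundary terms. Pointwise in t the pair sum in L_m P
-- collapses row by row through m(m aᵐ⁻¹bᵐ − aᵐ m bᵐ⁻¹) = (b − a)(m aᵐ⁻¹)(m bᵐ⁻¹), which yields the
-- heat-type identity L_m P = ∂ₜ²P. Hence L_m(tᵏP) = tᵏ∂ₜ²P = ∂ₜ(∂ₜ(tᵏP) − 2k tᵏ⁻¹P) + k(k−1)tᵏ⁻²P,
-- and the exact part integrates to terms that cancel the boundary terms, because (∂ₜ + ∂_c)P = 0
-- at t = x_c (the boundary terms of the first derivatives vanish since P(x_c) = 0 when m > 0).
-- Derivatives are formal: a value with its first two derivatives in one direction forms a jet, and
-- evaluating expressions and polynomials in t into jets is a ring homomorphism.

module Submission where

open import Defs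

import Algebra.Structures as Structures
open import Data.Bool using (true; false; if_then_else_)
open import Data.Empty using (⊥-elim)
open import Data.Fin as Fin using (Fin; zero; suc)
import Data.Fin.Properties as Finₚ
import Data.Integer as ℤ
import Data.Integer.Properties as ℤₚ
open import Data.List using (List; []; _∷_; map; length)
import Data.List.Properties as Listₚ
open import Data.List.Relation.Unary.All using (All; []; _∷_)
open import Data.Maybe using (Maybe; just; nothing)
open import Data.Nat as ℕ using (ℕ; zero; suc; _≤_)
import Data.Nat.Coprimality as Coprime
import Data.Nat.Properties as ℕₚ
open import Data.Product using (Σ; _×_; _,_)
open import Data.Rational as ℚ using (ℚ; 0ℚ; 1ℚ; mkℚ; _+_; _*_; -_; _-_)
import Data.Rational.Properties as ℚₚ
open import Relation.Binary.PropositionalEquality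
open import Relation.Nullary using (yes; no; does)
open import Tactic.RingSolver using (solve-∀)
open import Tactic.RingSolver.Core.AlmostCommutativeRing
  using (AlmostCommutativeRing; fromCommutativeRing)

open ≡-Reasoning

cong₃ : ∀ {A B C E : Set} (f : A → B → C → E) {a a′ b b′ c c′} →
        a ≡ a′ → b ≡ b′ → c ≡ c′ → f a b c ≡ f a′ b′ c′
cong₃ f refl refl refl = refl

ℚ-ring : AlmostCommutativeRing _ _
ℚ-ring = fromCommutativeRing ℚₚ.+-*-commutativeRing 0≟
  where
  0≟ : (p : ℚ) → Maybe (0ℚ ≡ p)
  0≟ p with 0ℚ ℚₚ.≟ p
  ... | yes 0≡p = just 0≡p
  ... | no _    = nothing

ℕ→ℚ-mkℚ : ∀ k → ℕ→ℚ k ≡ mkℚ (ℤ.+ k) 0 (Coprime.sym (Coprime.1-coprimeTo k))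
ℕ→ℚ-mkℚ k = ℚₚ.normalize-coprime (Coprime.sym (Coprime.1-coprimeTo k))

ℕ→ℚ-+ : ∀ a b → ℕ→ℚ (a ℕ.+ b) ≡ ℕ→ℚ a + ℕ→ℚ b
ℕ→ℚ-+ a b rewrite ℕ→ℚ-mkℚ a | ℕ→ℚ-mkℚ b =
  ℚₚ./-cong {p₁ = ℤ.+ (a ℕ.+ b)} {q₁ = 1}
    (trans (ℤₚ.pos-+ a b) (sym (cong₂ ℤ._+_ (ℤₚ.*-identityʳ (ℤ.+ a)) (ℤₚ.*-identityʳ (ℤ.+ b))))) refl

ℕ→ℚ-* : ∀ a b → ℕ→ℚ (a ℕ.* b) ≡ ℕ→ℚ a * ℕ→ℚ b
ℕ→ℚ-* a b rewrite ℕ→ℚ-mkℚ a | ℕ→ℚ-mkℚ b =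
  ℚₚ./-cong {p₁ = ℤ.+ (a ℕ.* b)} {q₁ = 1} (ℤₚ.pos-* a b) refl

ℕ→ℚ-suc : ∀ k → ℕ→ℚ (suc k) ≡ 1ℚ + ℕ→ℚ k
ℕ→ℚ-suc = ℕ→ℚ-+ 1

ℕ→ℚ-double : ∀ k → ℕ→ℚ (2 ℕ.* k) ≡ (1ℚ + 1ℚ) * ℕ→ℚ k
ℕ→ℚ-double k = trans (ℕ→ℚ-* 2 k) (cong (_* ℕ→ℚ k) (ℕ→ℚ-+ 1 1))

ℕ→ℚ-injective : ∀ {a b} → ℕ→ℚ a ≡ ℕ→ℚ b → a ≡ b
ℕ→ℚ-injective {a} {b} eq =
  cong (λ q → ℤ.∣ ℚ.↥ q ∣) (trans (sym (ℕ→ℚ-mkℚ a)) (trans eq (ℕ→ℚ-mkℚ b)))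

ℕ→ℚ-suc-*-1/suc : ∀ d → ℕ→ℚ (suc d) * (ℤ.+ 1 ℚ./ suc d) ≡ 1ℚ
ℕ→ℚ-suc-*-1/suc d =
  trans (cong₂ _*_ (ℕ→ℚ-mkℚ (suc d)) (ℚₚ.normalize-coprime (Coprime.1-coprimeTo (suc d))))
        (ℚₚ.*-inverseʳ (mkℚ (ℤ.+ suc d) 0 (Coprime.sym (Coprime.1-coprimeTo (suc d)))))

inv-inverseˡ : ∀ p → p ≢ 0ℚ → inv p * p ≡ 1ℚ
inv-inverseˡ p p≢0 with p ℚₚ.≟ 0ℚ
... | yes p≡0 = ⊥-elim (p≢0 p≡0)
... | no p≢0′ = ℚₚ.*-inverseˡ p {{ℚ.≢-nonZero p≢0′}}

x≢0∧x*y≡0⇒y≡0 : ∀ x y → x ≢ 0ℚ → x * y ≡ 0ℚ → y ≡ 0ℚ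
x≢0∧x*y≡0⇒y≡0 x y x≢0 xy≡0 = begin
  y               ≡⟨ sym (ℚₚ.*-identityˡ y) ⟩
  1ℚ * y          ≡⟨ cong (_* y) (sym (inv-inverseˡ x x≢0)) ⟩
  (inv x * x) * y ≡⟨ ℚₚ.*-assoc (inv x) x y ⟩
  inv x * (x * y) ≡⟨ cong (inv x *_) xy≡0 ⟩
  inv x * 0ℚ      ≡⟨ ℚₚ.*-zeroʳ (inv x) ⟩
  0ℚ              ∎

x-y≡0⇒x≡y : ∀ x y → x - y ≡ 0ℚ → x ≡ y
x-y≡0⇒x≡y x y x-y≡0 = begin
  x             ≡⟨ x≡x-y+y x y ⟩
  (x - y) + y   ≡⟨ cong (_+ y) x-y≡0 ⟩
  0ℚ + y        ≡⟨ ℚₚ.+-identityˡ y ⟩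
  y             ∎
  where
  x≡x-y+y : ∀ x y → x ≡ (x - y) + y
  x≡x-y+y = solve-∀ ℚ-ring

x≡y⇒x-y≡0 : ∀ {x y} → x ≡ y → x - y ≡ 0ℚ
x≡y⇒x-y≡0 {x} refl = ℚₚ.+-inverseʳ x

x≢y⇒x-y≢0 : ∀ x y → x ≢ y → x - y ≢ 0ℚ
x≢y⇒x-y≢0 x y x≢y x-y≡0 = x≢y (x-y≡0⇒x≡y x y x-y≡0)

sumFin-cong : ∀ N {f g : Fin N → ℚ} → (∀ i → f i ≡ g i) → sumFin N f ≡ sumFin N g
sumFin-cong zero    f≗g = refl
sumFin-cong (suc N) f≗g = cong₂ _+_ (f≗g zero) (sumFin-cong N (λ i → f≗g (suc i)))

sumFin-+ : ∀ N (f g : Fin N → ℚ) → sumFin N (λ i → f i + g i) ≡ sumFin N f + sumFin N g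
sumFin-+ zero    f g = sym (ℚₚ.+-identityˡ 0ℚ)
sumFin-+ (suc N) f g =
  trans (cong ((f zero + g zero) +_) (sumFin-+ N (λ i → f (suc i)) (λ i → g (suc i))))
        (interchange (f zero) (g zero) (sumFin N (λ i → f (suc i))) (sumFin N (λ i → g (suc i))))
  where
  interchange : ∀ a b c d → (a + b) + (c + d) ≡ (a + c) + (b + d)
  interchange = solve-∀ ℚ-ring

sumFin-* : ∀ N c (f : Fin N → ℚ) → sumFin N (λ i → c * f i) ≡ c * sumFin N f
sumFin-* zero    c f = sym (ℚₚ.*-zeroʳ c)
sumFin-* (suc N) c f =
  trans (cong (c * f zero +_) (sumFin-* N c (λ i → f (suc i))))
        (sym (ℚₚ.*-distribˡ-+ c (f zero) (sumFin N (λ i → f (suc i)))))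

sumFin-neg : ∀ N (f : Fin N → ℚ) → sumFin N (λ i → - f i) ≡ - sumFin N f
sumFin-neg zero    f = refl
sumFin-neg (suc N) f =
  trans (cong (- f zero +_) (sumFin-neg N (λ i → f (suc i))))
        (sym (ℚₚ.neg-distrib-+ (f zero) (sumFin N (λ i → f (suc i)))))

sumFin-sub : ∀ N (f g : Fin N → ℚ) → sumFin N (λ i → f i - g i) ≡ sumFin N f - sumFin N g
sumFin-sub N f g = trans (sumFin-+ N f (λ i → - g i)) (cong (sumFin N f +_) (sumFin-neg N g))

sumFin-0 : ∀ N → sumFin N (λ _ → 0ℚ) ≡ 0ℚ
sumFin-0 zero    = refl
sumFin-0 (suc N) = trans (cong (0ℚ +_) (sumFin-0 N)) (ℚₚ.+-identityˡ 0ℚ)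

δ : ∀ {N} → Fin N → Fin N → ℚ
δ i l = if does (i Fin.≟ l) then 1ℚ else 0ℚ

δ*δ≡δ : ∀ {N} (i l : Fin N) → δ i l * δ i l ≡ δ i l
δ*δ≡δ i l with does (i Fin.≟ l)
... | true  = ℚₚ.*-identityˡ 1ℚ
... | false = ℚₚ.*-zeroˡ 0ℚ

sumFin-δ : ∀ N (c : Fin N) (f : Fin N → ℚ) → sumFin N (λ i → δ i c * f i) ≡ f c
sumFin-δ (suc N) zero f = begin
  1ℚ * f zero + sumFin N (λ i → 0ℚ * f (suc i))
    ≡⟨ cong (1ℚ * f zero +_) (trans (sumFin-cong N (λ i → ℚₚ.*-zeroˡ (f (suc i)))) (sumFin-0 N)) ⟩
  1ℚ * f zero + 0ℚ ≡⟨ ℚₚ.+-identityʳ (1ℚ * f zero) ⟩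
  1ℚ * f zero      ≡⟨ ℚₚ.*-identityˡ (f zero) ⟩
  f zero           ∎
sumFin-δ (suc N) (suc c) f = begin
  0ℚ * f zero + sumFin N (λ i → δ i c * f (suc i)) ≡⟨ cong (_+ sumFin N (λ i → δ i c * f (suc i))) (ℚₚ.*-zeroˡ (f zero)) ⟩
  0ℚ + sumFin N (λ i → δ i c * f (suc i))          ≡⟨ ℚₚ.+-identityˡ _ ⟩
  sumFin N (λ i → δ i c * f (suc i))               ≡⟨ sumFin-δ N c (λ i → f (suc i)) ⟩
  f (suc c)                                        ∎

pairSum : ∀ N → (Fin N → ℚ) → (Fin N → ℚ) → ℚ
pairSum N x g = sumFin N (λ i → sumFin N (λ l →
  if does (i Fin.<? l) then inv (x i - x l) * (g i - g l) else 0ℚ))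

pairSum-suc : ∀ N x g → pairSum (suc N) x g ≡
  sumFin N (λ l → inv (x zero - x (suc l)) * (g zero - g (suc l)))
  + pairSum N (λ i → x (suc i)) (λ i → g (suc i))
pairSum-suc N x g = cong₂ _+_
  (ℚₚ.+-identityˡ (sumFin N (λ l → inv (x zero - x (suc l)) * (g zero - g (suc l)))))
  (sumFin-cong N (λ i → ℚₚ.+-identityˡ (sumFin N (λ l →
    if does (i Fin.<? l) then inv (x (suc i) - x (suc l)) * (g (suc i) - g (suc l)) else 0ℚ))))

pairSum-cong : ∀ N x {g h : Fin N → ℚ} → (∀ i → g i ≡ h i) → pairSum N x g ≡ pairSum N x h
pairSum-cong N x {g} {h} g≗h = sumFin-cong N (λ i → sumFin-cong N (λ l → term (does (i Fin.<? l)) i l))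
  where
  term : ∀ b i l → (if b then inv (x i - x l) * (g i - g l) else 0ℚ)
                 ≡ (if b then inv (x i - x l) * (h i - h l) else 0ℚ)
  term true  i l = cong (λ z → inv (x i - x l) * z) (cong₂ _-_ (g≗h i) (g≗h l))
  term false i l = refl

pairSum-* : ∀ N x c (g : Fin N → ℚ) → pairSum N x (λ i → c * g i) ≡ c * pairSum N x g
pairSum-* N x c g =
  trans (sumFin-cong N (λ i → trans (sumFin-cong N (λ l → term (does (i Fin.<? l)) i l))
                                    (sumFin-* N c _)))
        (sumFin-* N c _)
  where
  pull : ∀ q c a b → q * (c * a - c * b) ≡ c * (q * (a - b))
  pull = solve-∀ ℚ-ring
  term : ∀ b i l → (if b then inv (x i - x l) * (c * g i - c * g l) else 0ℚ)
                 ≡ c * (if b then inv (x i - x l) * (g i - g l) else 0ℚ)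
  term true  i l = pull (inv (x i - x l)) c (g i) (g l)
  term false i l = sym (ℚₚ.*-zeroʳ c)

pairSum-+ : ∀ N x (f g : Fin N → ℚ) → pairSum N x (λ i → f i + g i) ≡ pairSum N x f + pairSum N x g
pairSum-+ N x f g =
  trans (sumFin-cong N (λ i → trans (sumFin-cong N (λ l → term (does (i Fin.<? l)) i l))
                                    (sumFin-+ N _ _)))
        (sumFin-+ N _ _)
  where
  split : ∀ q a b c d → q * ((a + b) - (c + d)) ≡ q * (a - c) + q * (b - d)
  split = solve-∀ ℚ-ring
  term : ∀ b i l → (if b then inv (x i - x l) * ((f i + g i) - (f l + g l)) else 0ℚ)
                 ≡ (if b then inv (x i - x l) * (f i - f l) else 0ℚ)
                   + (if b then inv (x i - x l) * (g i - g l) else 0ℚ)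
  term true  i l = split (inv (x i - x l)) (f i) (g i) (f l) (g l)
  term false i l = sym (ℚₚ.+-identityˡ 0ℚ)

pairSum-0 : ∀ N x → pairSum N x (λ _ → 0ℚ) ≡ 0ℚ
pairSum-0 N x = begin
  pairSum N x (λ _ → 0ℚ)        ≡⟨ pairSum-cong N x (λ _ → sym (ℚₚ.*-zeroˡ 0ℚ)) ⟩
  pairSum N x (λ _ → 0ℚ * 0ℚ)   ≡⟨ pairSum-* N x 0ℚ (λ _ → 0ℚ) ⟩
  0ℚ * pairSum N x (λ _ → 0ℚ)   ≡⟨ ℚₚ.*-zeroˡ (pairSum N x (λ _ → 0ℚ)) ⟩
  0ℚ                            ∎

-- Second-order jets

-- A jet (f, f′, f″) records a value with its first two derivatives along one direction;
-- the product is the Leibniz rule (fg)″ = f″g + 2f′g′ + fg″.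
record Jet : Set where
  constructor jet
  field
    j₀ j₁ j₂ : ℚ
open Jet

infixl 6 _+ᴶ_
infixl 7 _*ᴶ_

_+ᴶ_ : Jet → Jet → Jet
p +ᴶ q = jet (j₀ p + j₀ q) (j₁ p + j₁ q) (j₂ p + j₂ q)

_*ᴶ_ : Jet → Jet → Jet
p *ᴶ q = jet (j₀ p * j₀ q) (j₁ p * j₀ q + j₀ p * j₁ q)
             ((j₂ p * j₀ q + j₁ p * j₁ q) + (j₁ p * j₁ q + j₀ p * j₂ q))

-ᴶ_ : Jet → Jet
-ᴶ p = jet (- j₀ p) (- j₁ p) (- j₂ p)

constᴶ : ℚ → Jet
constᴶ c = jet c 0ℚ 0ℚ

0ᴶ 1ᴶ : Jet
0ᴶ = constᴶ 0ℚ
1ᴶ = constᴶ 1ℚ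

jet-cong : ∀ {a b c d e f} → a ≡ d → b ≡ e → c ≡ f → jet a b c ≡ jet d e f
jet-cong refl refl refl = refl

+ᴶ-assoc : ∀ p q r → (p +ᴶ q) +ᴶ r ≡ p +ᴶ (q +ᴶ r)
+ᴶ-assoc p q r = jet-cong (ℚₚ.+-assoc (j₀ p) (j₀ q) (j₀ r)) (ℚₚ.+-assoc (j₁ p) (j₁ q) (j₁ r))
                         (ℚₚ.+-assoc (j₂ p) (j₂ q) (j₂ r))

+ᴶ-comm : ∀ p q → p +ᴶ q ≡ q +ᴶ p
+ᴶ-comm p q = jet-cong (ℚₚ.+-comm (j₀ p) (j₀ q)) (ℚₚ.+-comm (j₁ p) (j₁ q)) (ℚₚ.+-comm (j₂ p) (j₂ q))

+ᴶ-identityˡ : ∀ p → 0ᴶ +ᴶ p ≡ p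
+ᴶ-identityˡ p = jet-cong (ℚₚ.+-identityˡ (j₀ p)) (ℚₚ.+-identityˡ (j₁ p)) (ℚₚ.+-identityˡ (j₂ p))

+ᴶ-identityʳ : ∀ p → p +ᴶ 0ᴶ ≡ p
+ᴶ-identityʳ p = trans (+ᴶ-comm p 0ᴶ) (+ᴶ-identityˡ p)

+ᴶ-inverseˡ : ∀ p → (-ᴶ p) +ᴶ p ≡ 0ᴶ
+ᴶ-inverseˡ p = jet-cong (ℚₚ.+-inverseˡ (j₀ p)) (ℚₚ.+-inverseˡ (j₁ p)) (ℚₚ.+-inverseˡ (j₂ p))

+ᴶ-inverseʳ : ∀ p → p +ᴶ (-ᴶ p) ≡ 0ᴶ
+ᴶ-inverseʳ p = trans (+ᴶ-comm p (-ᴶ p)) (+ᴶ-inverseˡ p)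

*ᴶ-assoc : ∀ p q r → (p *ᴶ q) *ᴶ r ≡ p *ᴶ (q *ᴶ r)
*ᴶ-assoc (jet a b c) (jet d e f) (jet g h i) = jet-cong (as₀ a d g) (as₁ a b d e g h) (as₂ a b c d e f g h i)
  where
  as₀ : ∀ a d g → (a * d) * g ≡ a * (d * g)
  as₀ = solve-∀ ℚ-ring
  as₁ : ∀ a b d e g h → (b * d + a * e) * g + (a * d) * h ≡ b * (d * g) + a * (e * g + d * h)
  as₁ = solve-∀ ℚ-ring
  as₂ : ∀ a b c d e f g h i →
        (((c * d + b * e) + (b * e + a * f)) * g + (b * d + a * e) * h) + ((b * d + a * e) * h + (a * d) * i)
        ≡ (c * (d * g) + b * (e * g + d * h)) + (b * (e * g + d * h) + a * ((f * g + e * h) + (e * h + d * i)))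
  as₂ = solve-∀ ℚ-ring

*ᴶ-comm : ∀ p q → p *ᴶ q ≡ q *ᴶ p
*ᴶ-comm (jet a b c) (jet d e f) = jet-cong (cm₀ a d) (cm₁ a b d e) (cm₂ a b c d e f)
  where
  cm₀ : ∀ a d → a * d ≡ d * a
  cm₀ = solve-∀ ℚ-ring
  cm₁ : ∀ a b d e → b * d + a * e ≡ e * a + d * b
  cm₁ = solve-∀ ℚ-ring
  cm₂ : ∀ a b c d e f → (c * d + b * e) + (b * e + a * f) ≡ (f * a + e * b) + (e * b + d * c)
  cm₂ = solve-∀ ℚ-ring

*ᴶ-identityˡ : ∀ p → 1ᴶ *ᴶ p ≡ p
*ᴶ-identityˡ (jet a b c) = jet-cong (id₀ a) (id₁ a b) (id₂ a b c)
  where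
  id₀ : ∀ a → 1ℚ * a ≡ a
  id₀ = solve-∀ ℚ-ring
  id₁ : ∀ a b → 0ℚ * a + 1ℚ * b ≡ b
  id₁ = solve-∀ ℚ-ring
  id₂ : ∀ a b c → (0ℚ * a + 0ℚ * b) + (0ℚ * b + 1ℚ * c) ≡ c
  id₂ = solve-∀ ℚ-ring

*ᴶ-identityʳ : ∀ p → p *ᴶ 1ᴶ ≡ p
*ᴶ-identityʳ p = trans (*ᴶ-comm p 1ᴶ) (*ᴶ-identityˡ p)

*ᴶ-distribˡ-+ᴶ : ∀ p q r → p *ᴶ (q +ᴶ r) ≡ p *ᴶ q +ᴶ p *ᴶ r
*ᴶ-distribˡ-+ᴶ (jet a b c) (jet d e f) (jet g h i) = jet-cong (ds₀ a d g) (ds₁ a b d e g h) (ds₂ a b c d e f g h i)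
  where
  ds₀ : ∀ a d g → a * (d + g) ≡ a * d + a * g
  ds₀ = solve-∀ ℚ-ring
  ds₁ : ∀ a b d e g h → b * (d + g) + a * (e + h) ≡ (b * d + a * e) + (b * g + a * h)
  ds₁ = solve-∀ ℚ-ring
  ds₂ : ∀ a b c d e f g h i → (c * (d + g) + b * (e + h)) + (b * (e + h) + a * (f + i))
        ≡ ((c * d + b * e) + (b * e + a * f)) + ((c * g + b * h) + (b * h + a * i))
  ds₂ = solve-∀ ℚ-ring

*ᴶ-distribʳ-+ᴶ : ∀ p q r → (q +ᴶ r) *ᴶ p ≡ q *ᴶ p +ᴶ r *ᴶ p
*ᴶ-distribʳ-+ᴶ p q r =
  trans (*ᴶ-comm (q +ᴶ r) p) (trans (*ᴶ-distribˡ-+ᴶ p q r) (cong₂ _+ᴶ_ (*ᴶ-comm p q) (*ᴶ-comm p r)))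

Jet-isCommutativeRing : Structures.IsCommutativeRing {A = Jet} _≡_ _+ᴶ_ _*ᴶ_ -ᴶ_ 0ᴶ 1ᴶ
Jet-isCommutativeRing = record
  { isRing = record
    { +-isAbelianGroup = record
      { isGroup = record
        { isMonoid = record
          { isSemigroup = record
            { isMagma = record { isEquivalence = isEquivalence ; ∙-cong = cong₂ _+ᴶ_ }
            ; assoc = +ᴶ-assoc }
          ; identity = +ᴶ-identityˡ , +ᴶ-identityʳ }
        ; inverse = +ᴶ-inverseˡ , +ᴶ-inverseʳ
        ; ⁻¹-cong = cong -ᴶ_ }
      ; comm = +ᴶ-comm }
    ; *-cong = cong₂ _*ᴶ_
    ; *-assoc = *ᴶ-assoc
    ; *-identity = *ᴶ-identityˡ , *ᴶ-identityʳ
    ; distrib = *ᴶ-distribˡ-+ᴶ , *ᴶ-distribʳ-+ᴶ }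
  ; *-comm = *ᴶ-comm }

Jet-ring : AlmostCommutativeRing _ _
Jet-ring = fromCommutativeRing (record { isCommutativeRing = Jet-isCommutativeRing }) 0≟
  where
  0≟ : (p : Jet) → Maybe (0ᴶ ≡ p)
  0≟ (jet a b c) with 0ℚ ℚₚ.≟ a | 0ℚ ℚₚ.≟ b | 0ℚ ℚₚ.≟ c
  ... | yes 0≡a | yes 0≡b | yes 0≡c = just (jet-cong 0≡a 0≡b 0≡c)
  ... | _       | _       | _       = nothing

-- Polynomials in one variable with rational coefficients (ascending coefficient lists)

⟦_⟧ : List ℚ → ℚ → ℚ
⟦ []    ⟧ s = 0ℚ
⟦ c ∷ p ⟧ s = c + s * ⟦ p ⟧ s

infixl 6 _+ₚ_ _-ₚ_
infixr 7 _·ₚ_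

_+ₚ_ : List ℚ → List ℚ → List ℚ
[]      +ₚ q       = q
(a ∷ p) +ₚ []      = a ∷ p
(a ∷ p) +ₚ (b ∷ q) = (a + b) ∷ (p +ₚ q)

_·ₚ_ : ℚ → List ℚ → List ℚ
c ·ₚ []      = []
c ·ₚ (a ∷ p) = c * a ∷ c ·ₚ p

_-ₚ_ : List ℚ → List ℚ → List ℚ
p -ₚ q = p +ₚ (- 1ℚ) ·ₚ q

-- D differentiates in Horner form, (c + t q)′ = q + t q′; Dᶜ differentiates coefficientwise.
D : List ℚ → List ℚ
D []      = []
D (c ∷ p) = p +ₚ (0ℚ ∷ D p)

derivFrom : ℕ → List ℚ → List ℚ
derivFrom d []      = []
derivFrom d (a ∷ p) = ℕ→ℚ d * a ∷ derivFrom (suc d) p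

Dᶜ : List ℚ → List ℚ
Dᶜ []      = []
Dᶜ (a ∷ p) = derivFrom 1 p

antiderivFromℚ : ℕ → List ℚ → List ℚ
antiderivFromℚ d []      = []
antiderivFromℚ d (a ∷ p) = (ℤ.+ 1 ℚ./ suc d) * a ∷ antiderivFromℚ (suc d) p

antiderivℚ : List ℚ → List ℚ
antiderivℚ p = 0ℚ ∷ antiderivFromℚ 0 p

⟦⟧-+ₚ : ∀ p q s → ⟦ p +ₚ q ⟧ s ≡ ⟦ p ⟧ s + ⟦ q ⟧ s
⟦⟧-+ₚ []      q       s = sym (ℚₚ.+-identityˡ (⟦ q ⟧ s))
⟦⟧-+ₚ (a ∷ p) []      s = sym (ℚₚ.+-identityʳ (⟦ a ∷ p ⟧ s))
⟦⟧-+ₚ (a ∷ p) (b ∷ q) s =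
  trans (cong (λ z → (a + b) + s * z) (⟦⟧-+ₚ p q s)) (regroup a b s (⟦ p ⟧ s) (⟦ q ⟧ s))
  where
  regroup : ∀ a b s x y → (a + b) + s * (x + y) ≡ (a + s * x) + (b + s * y)
  regroup = solve-∀ ℚ-ring

⟦⟧-·ₚ : ∀ c p s → ⟦ c ·ₚ p ⟧ s ≡ c * ⟦ p ⟧ s
⟦⟧-·ₚ c []      s = sym (ℚₚ.*-zeroʳ c)
⟦⟧-·ₚ c (a ∷ p) s =
  trans (cong (λ z → c * a + s * z) (⟦⟧-·ₚ c p s)) (regroup c a s (⟦ p ⟧ s))
  where
  regroup : ∀ c a s x → c * a + s * (c * x) ≡ c * (a + s * x)
  regroup = solve-∀ ℚ-ring

x+[-1]*y≡x-y : ∀ x y → x + (- 1ℚ) * y ≡ x - y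
x+[-1]*y≡x-y = solve-∀ ℚ-ring

sumₚ : ∀ N → (Fin N → List ℚ) → List ℚ
sumₚ zero    f = []
sumₚ (suc N) f = f zero +ₚ sumₚ N (λ i → f (suc i))

pairSumₚ : ∀ N → (Fin N → ℚ) → (Fin N → List ℚ) → List ℚ
pairSumₚ N x f = sumₚ N (λ i → sumₚ N (λ l →
  if does (i Fin.<? l) then inv (x i - x l) ·ₚ (f i -ₚ f l) else []))

-- L_m applied coefficientwise, given the coefficients g₂ᵢ of ∂ᵢ² and g₁ᵢ of ∂ᵢ (c = 2m).
Lₚ : ∀ N → (Fin N → ℚ) → ℚ → (Fin N → List ℚ) → (Fin N → List ℚ) → List ℚ
Lₚ N x c g₂ g₁ = sumₚ N g₂ -ₚ c ·ₚ pairSumₚ N x g₁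

module Linear (Λ : List ℚ → ℚ) (Λ-[] : Λ [] ≡ 0ℚ)
              (Λ-+ₚ : ∀ p q → Λ (p +ₚ q) ≡ Λ p + Λ q)
              (Λ-·ₚ : ∀ c p → Λ (c ·ₚ p) ≡ c * Λ p) where

  Λ-subₚ : ∀ p q → Λ (p -ₚ q) ≡ Λ p - Λ q
  Λ-subₚ p q = trans (Λ-+ₚ p ((- 1ℚ) ·ₚ q))
                   (trans (cong (Λ p +_) (Λ-·ₚ (- 1ℚ) q)) (x+[-1]*y≡x-y (Λ p) (Λ q)))

  Λ-sumₚ : ∀ N f → Λ (sumₚ N f) ≡ sumFin N (λ i → Λ (f i))
  Λ-sumₚ zero    f = Λ-[]
  Λ-sumₚ (suc N) f = trans (Λ-+ₚ (f zero) (sumₚ N (λ i → f (suc i))))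
                           (cong (Λ (f zero) +_) (Λ-sumₚ N (λ i → f (suc i))))

  Λ-pairSumₚ : ∀ N x f → Λ (pairSumₚ N x f) ≡ pairSum N x (λ i → Λ (f i))
  Λ-pairSumₚ N x f =
    trans (Λ-sumₚ N _) (sumFin-cong N (λ i → trans (Λ-sumₚ N _) (sumFin-cong N (λ l → term (does (i Fin.<? l)) i l))))
    where
    term : ∀ b i l → Λ (if b then inv (x i - x l) ·ₚ (f i -ₚ f l) else [])
                   ≡ (if b then inv (x i - x l) * (Λ (f i) - Λ (f l)) else 0ℚ)
    term true  i l = trans (Λ-·ₚ (inv (x i - x l)) (f i -ₚ f l)) (cong (inv (x i - x l) *_) (Λ-subₚ (f i) (f l)))
    term false i l = Λ-[]

  Λ-Lₚ : ∀ N x c g₂ g₁ → Λ (Lₚ N x c g₂ g₁) ≡ sumFin N (λ i → Λ (g₂ i)) - c * pairSum N x (λ i → Λ (g₁ i))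
  Λ-Lₚ N x c g₂ g₁ = trans (Λ-subₚ (sumₚ N g₂) (c ·ₚ pairSumₚ N x g₁))
    (cong₂ _-_ (Λ-sumₚ N g₂) (trans (Λ-·ₚ c (pairSumₚ N x g₁)) (cong (c *_) (Λ-pairSumₚ N x g₁))))

⟦⟧-subₚ : ∀ p q s → ⟦ p -ₚ q ⟧ s ≡ ⟦ p ⟧ s - ⟦ q ⟧ s
⟦⟧-subₚ p q s = Linear.Λ-subₚ (λ r → ⟦ r ⟧ s) refl (λ p q → ⟦⟧-+ₚ p q s) (λ c p → ⟦⟧-·ₚ c p s) p q

⟦D∷⟧ : ∀ c p s → ⟦ D (c ∷ p) ⟧ s ≡ ⟦ p ⟧ s + s * ⟦ D p ⟧ s
⟦D∷⟧ c p s = trans (⟦⟧-+ₚ p (0ℚ ∷ D p) s) (cong (⟦ p ⟧ s +_) (ℚₚ.+-identityˡ (s * ⟦ D p ⟧ s)))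

⟦D⟧-+ₚ : ∀ p q s → ⟦ D (p +ₚ q) ⟧ s ≡ ⟦ D p ⟧ s + ⟦ D q ⟧ s
⟦D⟧-+ₚ []      q       s = sym (ℚₚ.+-identityˡ (⟦ D q ⟧ s))
⟦D⟧-+ₚ (a ∷ p) []      s = sym (ℚₚ.+-identityʳ (⟦ D (a ∷ p) ⟧ s))
⟦D⟧-+ₚ (a ∷ p) (b ∷ q) s = begin
  ⟦ D ((a + b) ∷ (p +ₚ q)) ⟧ s                   ≡⟨ ⟦D∷⟧ (a + b) (p +ₚ q) s ⟩
  ⟦ p +ₚ q ⟧ s + s * ⟦ D (p +ₚ q) ⟧ s            ≡⟨ cong₂ (λ u v → u + s * v) (⟦⟧-+ₚ p q s) (⟦D⟧-+ₚ p q s) ⟩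
  (⟦ p ⟧ s + ⟦ q ⟧ s) + s * (⟦ D p ⟧ s + ⟦ D q ⟧ s) ≡⟨ regroup (⟦ p ⟧ s) (⟦ q ⟧ s) s (⟦ D p ⟧ s) (⟦ D q ⟧ s) ⟩
  (⟦ p ⟧ s + s * ⟦ D p ⟧ s) + (⟦ q ⟧ s + s * ⟦ D q ⟧ s) ≡⟨ sym (cong₂ _+_ (⟦D∷⟧ a p s) (⟦D∷⟧ b q s)) ⟩
  ⟦ D (a ∷ p) ⟧ s + ⟦ D (b ∷ q) ⟧ s              ∎
  where
  regroup : ∀ x y s u v → (x + y) + s * (u + v) ≡ (x + s * u) + (y + s * v)
  regroup = solve-∀ ℚ-ring

⟦D⟧-·ₚ : ∀ c p s → ⟦ D (c ·ₚ p) ⟧ s ≡ c * ⟦ D p ⟧ s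
⟦D⟧-·ₚ c []      s = sym (ℚₚ.*-zeroʳ c)
⟦D⟧-·ₚ c (a ∷ p) s = begin
  ⟦ D (c * a ∷ c ·ₚ p) ⟧ s                 ≡⟨ ⟦D∷⟧ (c * a) (c ·ₚ p) s ⟩
  ⟦ c ·ₚ p ⟧ s + s * ⟦ D (c ·ₚ p) ⟧ s      ≡⟨ cong₂ (λ u v → u + s * v) (⟦⟧-·ₚ c p s) (⟦D⟧-·ₚ c p s) ⟩
  c * ⟦ p ⟧ s + s * (c * ⟦ D p ⟧ s)        ≡⟨ regroup c (⟦ p ⟧ s) s (⟦ D p ⟧ s) ⟩
  c * (⟦ p ⟧ s + s * ⟦ D p ⟧ s)            ≡⟨ cong (c *_) (sym (⟦D∷⟧ a p s)) ⟩
  c * ⟦ D (a ∷ p) ⟧ s                      ∎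
  where
  regroup : ∀ c x s u → c * x + s * (c * u) ≡ c * (x + s * u)
  regroup = solve-∀ ℚ-ring

⟦D⟧-subₚ : ∀ p q s → ⟦ D (p -ₚ q) ⟧ s ≡ ⟦ D p ⟧ s - ⟦ D q ⟧ s
⟦D⟧-subₚ p q s = Linear.Λ-subₚ (λ r → ⟦ D r ⟧ s) refl (λ p q → ⟦D⟧-+ₚ p q s) (λ c p → ⟦D⟧-·ₚ c p s) p q

⟦DD∷⟧ : ∀ c p s → ⟦ D (D (c ∷ p)) ⟧ s ≡ (⟦ D p ⟧ s + ⟦ D p ⟧ s) + s * ⟦ D (D p) ⟧ s
⟦DD∷⟧ c p s = begin
  ⟦ D (p +ₚ (0ℚ ∷ D p)) ⟧ s                    ≡⟨ ⟦D⟧-+ₚ p (0ℚ ∷ D p) s ⟩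
  ⟦ D p ⟧ s + ⟦ D (0ℚ ∷ D p) ⟧ s               ≡⟨ cong (⟦ D p ⟧ s +_) (⟦D∷⟧ 0ℚ (D p) s) ⟩
  ⟦ D p ⟧ s + (⟦ D p ⟧ s + s * ⟦ D (D p) ⟧ s)  ≡⟨ sym (ℚₚ.+-assoc (⟦ D p ⟧ s) (⟦ D p ⟧ s) _) ⟩
  (⟦ D p ⟧ s + ⟦ D p ⟧ s) + s * ⟦ D (D p) ⟧ s  ∎

⟦derivFrom-suc⟧ : ∀ d p s → ⟦ derivFrom (suc d) p ⟧ s ≡ ⟦ p ⟧ s + ⟦ derivFrom d p ⟧ s
⟦derivFrom-suc⟧ d []      s = sym (ℚₚ.+-identityˡ 0ℚ)
⟦derivFrom-suc⟧ d (a ∷ p) s = begin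
  ℕ→ℚ (suc d) * a + s * ⟦ derivFrom (suc (suc d)) p ⟧ s
    ≡⟨ cong₂ (λ u v → u * a + s * v) (ℕ→ℚ-suc d) (⟦derivFrom-suc⟧ (suc d) p s) ⟩
  (1ℚ + ℕ→ℚ d) * a + s * (⟦ p ⟧ s + ⟦ derivFrom (suc d) p ⟧ s)
    ≡⟨ regroup (ℕ→ℚ d) a s (⟦ p ⟧ s) (⟦ derivFrom (suc d) p ⟧ s) ⟩
  (a + s * ⟦ p ⟧ s) + (ℕ→ℚ d * a + s * ⟦ derivFrom (suc d) p ⟧ s) ∎
  where
  regroup : ∀ d a s x y → (1ℚ + d) * a + s * (x + y) ≡ (a + s * x) + (d * a + s * y)
  regroup = solve-∀ ℚ-ring

⟦derivFrom-0⟧ : ∀ p s → ⟦ derivFrom 0 p ⟧ s ≡ s * ⟦ Dᶜ p ⟧ s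
⟦derivFrom-0⟧ []      s = sym (ℚₚ.*-zeroʳ s)
⟦derivFrom-0⟧ (a ∷ p) s = trans (cong (_+ s * ⟦ derivFrom 1 p ⟧ s) (ℚₚ.*-zeroˡ a)) (ℚₚ.+-identityˡ _)

⟦D⟧≡⟦Dᶜ⟧ : ∀ p s → ⟦ D p ⟧ s ≡ ⟦ Dᶜ p ⟧ s
⟦D⟧≡⟦Dᶜ⟧ []      s = refl
⟦D⟧≡⟦Dᶜ⟧ (a ∷ p) s = begin
  ⟦ D (a ∷ p) ⟧ s                 ≡⟨ ⟦D∷⟧ a p s ⟩
  ⟦ p ⟧ s + s * ⟦ D p ⟧ s         ≡⟨ cong (λ z → ⟦ p ⟧ s + s * z) (⟦D⟧≡⟦Dᶜ⟧ p s) ⟩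
  ⟦ p ⟧ s + s * ⟦ Dᶜ p ⟧ s        ≡⟨ cong (⟦ p ⟧ s +_) (sym (⟦derivFrom-0⟧ p s)) ⟩
  ⟦ p ⟧ s + ⟦ derivFrom 0 p ⟧ s   ≡⟨ sym (⟦derivFrom-suc⟧ 0 p s) ⟩
  ⟦ derivFrom 1 p ⟧ s             ∎

derivFrom∘antiderivFromℚ : ∀ d p → derivFrom (suc d) (antiderivFromℚ d p) ≡ p
derivFrom∘antiderivFromℚ d []      = refl
derivFrom∘antiderivFromℚ d (a ∷ p) = cong₂ _∷_ (begin
  ℕ→ℚ (suc d) * ((ℤ.+ 1 ℚ./ suc d) * a) ≡⟨ sym (ℚₚ.*-assoc (ℕ→ℚ (suc d)) (ℤ.+ 1 ℚ./ suc d) a) ⟩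
  (ℕ→ℚ (suc d) * (ℤ.+ 1 ℚ./ suc d)) * a ≡⟨ cong (_* a) (ℕ→ℚ-suc-*-1/suc d) ⟩
  1ℚ * a                               ≡⟨ ℚₚ.*-identityˡ a ⟩
  a                                    ∎) (derivFrom∘antiderivFromℚ (suc d) p)

antiderivFromℚ∘derivFrom : ∀ d p → antiderivFromℚ d (derivFrom (suc d) p) ≡ p
antiderivFromℚ∘derivFrom d []      = refl
antiderivFromℚ∘derivFrom d (a ∷ p) = cong₂ _∷_ (begin
  (ℤ.+ 1 ℚ./ suc d) * (ℕ→ℚ (suc d) * a) ≡⟨ sym (ℚₚ.*-assoc (ℤ.+ 1 ℚ./ suc d) (ℕ→ℚ (suc d)) a) ⟩
  ((ℤ.+ 1 ℚ./ suc d) * ℕ→ℚ (suc d)) * a ≡⟨ cong (_* a) (trans (ℚₚ.*-comm (ℤ.+ 1 ℚ./ suc d) (ℕ→ℚ (suc d))) (ℕ→ℚ-suc-*-1/suc d)) ⟩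
  1ℚ * a                               ≡⟨ ℚₚ.*-identityˡ a ⟩
  a                                    ∎) (antiderivFromℚ∘derivFrom (suc d) p)

⟦D∘antiderivℚ⟧ : ∀ p s → ⟦ D (antiderivℚ p) ⟧ s ≡ ⟦ p ⟧ s
⟦D∘antiderivℚ⟧ p s = trans (⟦D⟧≡⟦Dᶜ⟧ (antiderivℚ p) s) (cong (λ q → ⟦ q ⟧ s) (derivFrom∘antiderivFromℚ 0 p))

IsZero : List ℚ → Set
IsZero = All (_≡ 0ℚ)

⟦⟧-IsZero : ∀ {p} → IsZero p → ∀ s → ⟦ p ⟧ s ≡ 0ℚ
⟦⟧-IsZero []           s = refl
⟦⟧-IsZero (refl ∷ p≡0) s =
  trans (cong (λ u → 0ℚ + s * u) (⟦⟧-IsZero p≡0 s))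
        (trans (ℚₚ.+-identityˡ (s * 0ℚ)) (ℚₚ.*-zeroʳ s))

⟦D⟧-IsZero : ∀ {p} → IsZero p → ∀ s → ⟦ D p ⟧ s ≡ 0ℚ
⟦D⟧-IsZero []                   s = refl
⟦D⟧-IsZero {a ∷ p} (refl ∷ p≡0) s =
  trans (⟦D∷⟧ a p s)
        (trans (cong₂ (λ u v → u + s * v) (⟦⟧-IsZero p≡0 s) (⟦D⟧-IsZero p≡0 s))
               (trans (ℚₚ.+-identityˡ (s * 0ℚ)) (ℚₚ.*-zeroʳ s)))

IsZero-antiderivFromℚ : ∀ {p} d → IsZero p → IsZero (antiderivFromℚ d p)
IsZero-antiderivFromℚ d []           = []
IsZero-antiderivFromℚ d (refl ∷ p≡0) = ℚₚ.*-zeroʳ (ℤ.+ 1 ℚ./ suc d) ∷ IsZero-antiderivFromℚ (suc d) p≡0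

-- Synthetic division by t - c.
quot : ℚ → List ℚ → List ℚ
quot c []          = []
quot c (a ∷ [])    = []
quot c (a ∷ b ∷ p) = ⟦ b ∷ p ⟧ c ∷ quot c (b ∷ p)

⟦⟧-quot : ∀ c p s → ⟦ p ⟧ s ≡ (s - c) * ⟦ quot c p ⟧ s + ⟦ p ⟧ c
⟦⟧-quot c []          s = sym (trans (ℚₚ.+-identityʳ _) (ℚₚ.*-zeroʳ (s - c)))
⟦⟧-quot c (a ∷ [])    s = constant a s c
  where
  constant : ∀ a s c → a + s * 0ℚ ≡ (s - c) * 0ℚ + (a + c * 0ℚ)
  constant = solve-∀ ℚ-ring
⟦⟧-quot c (a ∷ b ∷ p) s =
  trans (cong (λ u → a + s * u) (⟦⟧-quot c (b ∷ p) s)) (regroup a s c (⟦ quot c (b ∷ p) ⟧ s) (⟦ b ∷ p ⟧ c))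
  where
  regroup : ∀ a s c q y → a + s * ((s - c) * q + y) ≡ (s - c) * (y + s * q) + (a + c * y)
  regroup = solve-∀ ℚ-ring

length-quot : ∀ c a p → length (quot c (a ∷ p)) ≡ length p
length-quot c a []      = refl
length-quot c a (b ∷ p) = cong suc (length-quot c b p)

IsZero-quot : ∀ c p → IsZero (quot c p) → ⟦ p ⟧ c ≡ 0ℚ → IsZero p
IsZero-quot c []          _             _     = []
IsZero-quot c (a ∷ [])    _             p[c]≡0 = trans (sym (a+c*0≡a a c)) p[c]≡0 ∷ []
  where
  a+c*0≡a : ∀ a c → a + c * 0ℚ ≡ a
  a+c*0≡a = solve-∀ ℚ-ring
IsZero-quot c (a ∷ b ∷ p) (q₀≡0 ∷ q≡0) p[c]≡0 =
  trans (sym (a+c*0≡a a c)) (trans (cong (λ u → a + c * u) (sym q₀≡0)) p[c]≡0)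
  ∷ IsZero-quot c (b ∷ p) q≡0 q₀≡0
  where
  a+c*0≡a : ∀ a c → a + c * 0ℚ ≡ a
  a+c*0≡a = solve-∀ ℚ-ring

-- Induction on the length: divide out the root M; the quotient vanishes at every natural above M.
vanishing-above⇒IsZero : ∀ n p → length p ≡ n → ∀ M → (∀ r → ⟦ p ⟧ (ℕ→ℚ (M ℕ.+ r)) ≡ 0ℚ) → IsZero p
vanishing-above⇒IsZero zero    []      _   M p≡0 = []
vanishing-above⇒IsZero (suc n) (a ∷ p) len M p≡0 = IsZero-quot c (a ∷ p) quot≡0 p[c]≡0
  where
  c = ℕ→ℚ M
  p[c]≡0 : ⟦ a ∷ p ⟧ c ≡ 0ℚ
  p[c]≡0 = trans (cong (λ k → ⟦ a ∷ p ⟧ (ℕ→ℚ k)) (sym (ℕₚ.+-identityʳ M))) (p≡0 0)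
  quot-vanishes : ∀ r → ⟦ quot c (a ∷ p) ⟧ (ℕ→ℚ (suc M ℕ.+ r)) ≡ 0ℚ
  quot-vanishes r = x≢0∧x*y≡0⇒y≡0 (s - c) _ s-c≢0 (begin
    (s - c) * ⟦ quot c (a ∷ p) ⟧ s          ≡⟨ sym (ℚₚ.+-identityʳ _) ⟩
    (s - c) * ⟦ quot c (a ∷ p) ⟧ s + 0ℚ     ≡⟨ cong ((s - c) * ⟦ quot c (a ∷ p) ⟧ s +_) (sym p[c]≡0) ⟩
    (s - c) * ⟦ quot c (a ∷ p) ⟧ s + ⟦ a ∷ p ⟧ c ≡⟨ sym (⟦⟧-quot c (a ∷ p) s) ⟩
    ⟦ a ∷ p ⟧ s                             ≡⟨ cong (λ k → ⟦ a ∷ p ⟧ (ℕ→ℚ k)) (sym (ℕₚ.+-suc M r)) ⟩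
    ⟦ a ∷ p ⟧ (ℕ→ℚ (M ℕ.+ suc r))           ≡⟨ p≡0 (suc r) ⟩
    0ℚ                                      ∎)
    where
    s = ℕ→ℚ (suc M ℕ.+ r)
    s-c≢0 : s - c ≢ 0ℚ
    s-c≢0 = x≢y⇒x-y≢0 s c (λ s≡c → ℕₚ.m≢1+m+n M (sym (ℕ→ℚ-injective s≡c)))
  quot≡0 : IsZero (quot c (a ∷ p))
  quot≡0 = vanishing-above⇒IsZero n (quot c (a ∷ p)) (trans (length-quot c a p) (ℕₚ.suc-injective len))
             (suc M) quot-vanishes

vanishing⇒IsZero : ∀ p → (∀ s → ⟦ p ⟧ s ≡ 0ℚ) → IsZero p
vanishing⇒IsZero p p≡0 = vanishing-above⇒IsZero (length p) p refl 0 (λ r → p≡0 _)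

⟦⟧-≗⇒IsZero-subₚ : ∀ p q → (∀ s → ⟦ p ⟧ s ≡ ⟦ q ⟧ s) → IsZero (p -ₚ q)
⟦⟧-≗⇒IsZero-subₚ p q p≗q = vanishing⇒IsZero (p -ₚ q) (λ s →
  trans (⟦⟧-subₚ p q s) (trans (cong (λ u → ⟦ p ⟧ s - u) (sym (p≗q s))) (ℚₚ.+-inverseʳ (⟦ p ⟧ s))))

⟦D⟧-cong : ∀ p q → (∀ s → ⟦ p ⟧ s ≡ ⟦ q ⟧ s) → ∀ s → ⟦ D p ⟧ s ≡ ⟦ D q ⟧ s
⟦D⟧-cong p q p≗q s =
  x-y≡0⇒x≡y _ _ (trans (sym (⟦D⟧-subₚ p q s)) (⟦D⟧-IsZero (⟦⟧-≗⇒IsZero-subₚ p q p≗q) s))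

⟦antiderivFromℚ⟧-+ₚ : ∀ d p q s → ⟦ antiderivFromℚ d (p +ₚ q) ⟧ s ≡ ⟦ antiderivFromℚ d p ⟧ s + ⟦ antiderivFromℚ d q ⟧ s
⟦antiderivFromℚ⟧-+ₚ d []      q       s = sym (ℚₚ.+-identityˡ _)
⟦antiderivFromℚ⟧-+ₚ d (a ∷ p) []      s = sym (ℚₚ.+-identityʳ _)
⟦antiderivFromℚ⟧-+ₚ d (a ∷ p) (b ∷ q) s =
  trans (cong (λ u → (ℤ.+ 1 ℚ./ suc d) * (a + b) + s * u) (⟦antiderivFromℚ⟧-+ₚ (suc d) p q s))
        (regroup (ℤ.+ 1 ℚ./ suc d) a b s (⟦ antiderivFromℚ (suc d) p ⟧ s) (⟦ antiderivFromℚ (suc d) q ⟧ s))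
  where
  regroup : ∀ r a b s x y → r * (a + b) + s * (x + y) ≡ (r * a + s * x) + (r * b + s * y)
  regroup = solve-∀ ℚ-ring

⟦antiderivFromℚ⟧-·ₚ : ∀ d c p s → ⟦ antiderivFromℚ d (c ·ₚ p) ⟧ s ≡ c * ⟦ antiderivFromℚ d p ⟧ s
⟦antiderivFromℚ⟧-·ₚ d c []      s = sym (ℚₚ.*-zeroʳ c)
⟦antiderivFromℚ⟧-·ₚ d c (a ∷ p) s =
  trans (cong (λ u → (ℤ.+ 1 ℚ./ suc d) * (c * a) + s * u) (⟦antiderivFromℚ⟧-·ₚ (suc d) c p s))
        (regroup (ℤ.+ 1 ℚ./ suc d) c a s (⟦ antiderivFromℚ (suc d) p ⟧ s))
  where
  regroup : ∀ r c a s x → r * (c * a) + s * (c * x) ≡ c * (r * a + s * x)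
  regroup = solve-∀ ℚ-ring

⟦antiderivℚ⟧-+ₚ : ∀ p q s → ⟦ antiderivℚ (p +ₚ q) ⟧ s ≡ ⟦ antiderivℚ p ⟧ s + ⟦ antiderivℚ q ⟧ s
⟦antiderivℚ⟧-+ₚ p q s =
  trans (cong (λ u → 0ℚ + s * u) (⟦antiderivFromℚ⟧-+ₚ 0 p q s))
        (regroup s (⟦ antiderivFromℚ 0 p ⟧ s) (⟦ antiderivFromℚ 0 q ⟧ s))
  where
  regroup : ∀ s x y → 0ℚ + s * (x + y) ≡ (0ℚ + s * x) + (0ℚ + s * y)
  regroup = solve-∀ ℚ-ring

⟦antiderivℚ⟧-·ₚ : ∀ c p s → ⟦ antiderivℚ (c ·ₚ p) ⟧ s ≡ c * ⟦ antiderivℚ p ⟧ s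
⟦antiderivℚ⟧-·ₚ c p s =
  trans (cong (λ u → 0ℚ + s * u) (⟦antiderivFromℚ⟧-·ₚ 0 c p s)) (regroup s c (⟦ antiderivFromℚ 0 p ⟧ s))
  where
  regroup : ∀ s c x → 0ℚ + s * (c * x) ≡ c * (0ℚ + s * x)
  regroup = solve-∀ ℚ-ring

integral : ℚ → ℚ → List ℚ → ℚ
integral a b p = ⟦ antiderivℚ p ⟧ b - ⟦ antiderivℚ p ⟧ a

module _ (a b : ℚ) where

  integral-[] : integral a b [] ≡ 0ℚ
  integral-[] = zero-area a b
    where
    zero-area : ∀ a b → (0ℚ + b * 0ℚ) - (0ℚ + a * 0ℚ) ≡ 0ℚ
    zero-area = solve-∀ ℚ-ring

  integral-+ₚ : ∀ p q → integral a b (p +ₚ q) ≡ integral a b p + integral a b q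
  integral-+ₚ p q =
    trans (cong₂ _-_ (⟦antiderivℚ⟧-+ₚ p q b) (⟦antiderivℚ⟧-+ₚ p q a))
          (regroup (⟦ antiderivℚ p ⟧ b) (⟦ antiderivℚ q ⟧ b) (⟦ antiderivℚ p ⟧ a) (⟦ antiderivℚ q ⟧ a))
    where
    regroup : ∀ w x y z → (w + x) - (y + z) ≡ (w - y) + (x - z)
    regroup = solve-∀ ℚ-ring

  integral-·ₚ : ∀ c p → integral a b (c ·ₚ p) ≡ c * integral a b p
  integral-·ₚ c p =
    trans (cong₂ _-_ (⟦antiderivℚ⟧-·ₚ c p b) (⟦antiderivℚ⟧-·ₚ c p a))
          (regroup c (⟦ antiderivℚ p ⟧ b) (⟦ antiderivℚ p ⟧ a))
    where
    regroup : ∀ c x y → c * x - c * y ≡ c * (x - y)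
    regroup = solve-∀ ℚ-ring

  integral-subₚ : ∀ p q → integral a b (p -ₚ q) ≡ integral a b p - integral a b q
  integral-subₚ = Linear.Λ-subₚ (integral a b) integral-[] integral-+ₚ integral-·ₚ

  integral-IsZero : ∀ {p} → IsZero p → integral a b p ≡ 0ℚ
  integral-IsZero {p} p≡0 = trans (cong₂ _-_ (⟦⟧-IsZero 0∷p≡0 b) (⟦⟧-IsZero 0∷p≡0 a)) (ℚₚ.+-inverseʳ 0ℚ)
    where
    0∷p≡0 : IsZero (antiderivℚ p)
    0∷p≡0 = refl ∷ IsZero-antiderivFromℚ 0 p≡0

  integral-cong : ∀ p q → (∀ s → ⟦ p ⟧ s ≡ ⟦ q ⟧ s) → integral a b p ≡ integral a b q
  integral-cong p q p≗q =
    x-y≡0⇒x≡y _ _ (trans (sym (integral-subₚ p q)) (integral-IsZero (⟦⟧-≗⇒IsZero-subₚ p q p≗q)))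

  integral-D : ∀ p → integral a b (D p) ≡ ⟦ p ⟧ b - ⟦ p ⟧ a
  integral-D p = trans (integral-cong (D p) (Dᶜ p) (⟦D⟧≡⟦Dᶜ⟧ p)) (integral-Dᶜ p)
    where
    shift : ∀ c a b x y → (0ℚ + b * y) - (0ℚ + a * x) ≡ (c + b * y) - (c + a * x)
    shift = solve-∀ ℚ-ring
    integral-Dᶜ : ∀ p → integral a b (Dᶜ p) ≡ ⟦ p ⟧ b - ⟦ p ⟧ a
    integral-Dᶜ []      = integral-[]
    integral-Dᶜ (c ∷ p) =
      trans (cong (λ q → ⟦ 0ℚ ∷ q ⟧ b - ⟦ 0ℚ ∷ q ⟧ a) (antiderivFromℚ∘derivFrom 0 p))
            (shift c a b (⟦ p ⟧ a) (⟦ p ⟧ b))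

-- Polynomials in one variable with jet coefficients

⟦_⟧ᴶ : List Jet → Jet → Jet
⟦ []    ⟧ᴶ y = 0ᴶ
⟦ c ∷ p ⟧ᴶ y = c +ᴶ y *ᴶ ⟦ p ⟧ᴶ y

π₀ π₁ π₂ : List Jet → List ℚ
π₀ = map j₀
π₁ = map j₁
π₂ = map j₂

-- Chain rule: a polynomial in t with jet coefficients, evaluated along t = s + δ·(direction).
⟦⟧ᴶ-chain-rule : ∀ p s δ → ⟦ p ⟧ᴶ (jet s δ 0ℚ) ≡
  jet (⟦ π₀ p ⟧ s) (⟦ π₁ p ⟧ s + δ * ⟦ D (π₀ p) ⟧ s)
      ((⟦ π₂ p ⟧ s + (δ + δ) * ⟦ D (π₁ p) ⟧ s) + (δ * δ) * ⟦ D (D (π₀ p)) ⟧ s)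
⟦⟧ᴶ-chain-rule []      s δ = sym (jet-cong refl (zero₁ δ) (zero₂ δ))
  where
  zero₁ : ∀ δ → 0ℚ + δ * 0ℚ ≡ 0ℚ
  zero₁ = solve-∀ ℚ-ring
  zero₂ : ∀ δ → (0ℚ + (δ + δ) * 0ℚ) + (δ * δ) * 0ℚ ≡ 0ℚ
  zero₂ = solve-∀ ℚ-ring
⟦⟧ᴶ-chain-rule (c ∷ p) s δ rewrite ⟦⟧ᴶ-chain-rule p s δ = jet-cong refl first second
  where
  A = ⟦ π₀ p ⟧ s
  P₁ = ⟦ π₁ p ⟧ s
  P₂ = ⟦ π₂ p ⟧ s
  D₀ = ⟦ D (π₀ p) ⟧ s
  D₁ = ⟦ D (π₁ p) ⟧ s
  DD₀ = ⟦ D (D (π₀ p)) ⟧ s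
  B = P₁ + δ * D₀
  C = (P₂ + (δ + δ) * D₁) + (δ * δ) * DD₀
  regroup₁ : ∀ c₁ δ s A P₁ D₀ → c₁ + (δ * A + s * (P₁ + δ * D₀)) ≡ (c₁ + s * P₁) + δ * (A + s * D₀)
  regroup₁ = solve-∀ ℚ-ring
  regroup₂ : ∀ c₂ δ s A P₁ P₂ D₀ D₁ DD₀ →
    c₂ + ((0ℚ * A + δ * (P₁ + δ * D₀)) + (δ * (P₁ + δ * D₀) + s * ((P₂ + (δ + δ) * D₁) + (δ * δ) * DD₀)))
    ≡ ((c₂ + s * P₂) + (δ + δ) * (P₁ + s * D₁)) + (δ * δ) * ((D₀ + D₀) + s * DD₀)
  regroup₂ = solve-∀ ℚ-ring
  first : j₁ c + (δ * A + s * B) ≡ (j₁ c + s * P₁) + δ * ⟦ D (j₀ c ∷ π₀ p) ⟧ s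
  first = trans (regroup₁ (j₁ c) δ s A P₁ D₀) (cong (λ u → (j₁ c + s * P₁) + δ * u) (sym (⟦D∷⟧ (j₀ c) (π₀ p) s)))
  second : j₂ c + ((0ℚ * A + δ * B) + (δ * B + s * C))
         ≡ ((j₂ c + s * P₂) + (δ + δ) * ⟦ D (j₁ c ∷ π₁ p) ⟧ s) + (δ * δ) * ⟦ D (D (j₀ c ∷ π₀ p)) ⟧ s
  second = trans (regroup₂ (j₂ c) δ s A P₁ P₂ D₀ D₁ DD₀)
                 (cong₂ (λ u v → ((j₂ c + s * P₂) + (δ + δ) * u) + (δ * δ) * v)
                        (sym (⟦D∷⟧ (j₁ c) (π₁ p) s)) (sym (⟦DD∷⟧ (j₀ c) (π₀ p) s)))

⟦⟧ᴶ-const : ∀ p s → ⟦ p ⟧ᴶ (constᴶ s) ≡ jet (⟦ π₀ p ⟧ s) (⟦ π₁ p ⟧ s) (⟦ π₂ p ⟧ s)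
⟦⟧ᴶ-const p s = trans (⟦⟧ᴶ-chain-rule p s 0ℚ) (jet-cong refl
  (trans (cong (⟦ π₁ p ⟧ s +_) (ℚₚ.*-zeroˡ (⟦ D (π₀ p) ⟧ s))) (ℚₚ.+-identityʳ (⟦ π₁ p ⟧ s)))
  (trans (cong₂ (λ a b → (⟦ π₂ p ⟧ s + a) + b) (ℚₚ.*-zeroˡ (⟦ D (π₁ p) ⟧ s)) (ℚₚ.*-zeroˡ (⟦ D (D (π₀ p)) ⟧ s)))
         (trans (ℚₚ.+-identityʳ (⟦ π₂ p ⟧ s + 0ℚ)) (ℚₚ.+-identityʳ (⟦ π₂ p ⟧ s)))))

IsZero-π₁-constᴶ : ∀ p → IsZero (π₁ (map constᴶ p))
IsZero-π₁-constᴶ []      = []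
IsZero-π₁-constᴶ (_ ∷ p) = refl ∷ IsZero-π₁-constᴶ p

IsZero-π₂-constᴶ : ∀ p → IsZero (π₂ (map constᴶ p))
IsZero-π₂-constᴶ []      = []
IsZero-π₂-constᴶ (_ ∷ p) = refl ∷ IsZero-π₂-constᴶ p

⟦map-constᴶ⟧ : ∀ p s → ⟦ map constᴶ p ⟧ᴶ (jet s 1ℚ 0ℚ) ≡ jet (⟦ p ⟧ s) (⟦ D p ⟧ s) (⟦ D (D p) ⟧ s)
⟦map-constᴶ⟧ p s = trans (⟦⟧ᴶ-chain-rule (map constᴶ p) s 1ℚ) (jet-cong
  (cong (λ q → ⟦ q ⟧ s) π₀≡p)
  (trans (cong₂ (λ a b → a + 1ℚ * b) (⟦⟧-IsZero (IsZero-π₁-constᴶ p) s) (cong (λ q → ⟦ D q ⟧ s) π₀≡p))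
         (lead₁ (⟦ D p ⟧ s)))
  (trans (cong₃ (λ a b c → (a + (1ℚ + 1ℚ) * b) + (1ℚ * 1ℚ) * c)
                (⟦⟧-IsZero (IsZero-π₂-constᴶ p) s) (⟦D⟧-IsZero (IsZero-π₁-constᴶ p) s) (cong (λ q → ⟦ D (D q) ⟧ s) π₀≡p))
         (lead₂ (⟦ D (D p) ⟧ s))))
  where
  π₀≡p : π₀ (map constᴶ p) ≡ p
  π₀≡p = trans (sym (Listₚ.map-∘ p)) (Listₚ.map-id p)
  lead₁ : ∀ a → 0ℚ + 1ℚ * a ≡ a
  lead₁ = solve-∀ ℚ-ring
  lead₂ : ∀ a → (0ℚ + (1ℚ + 1ℚ) * 0ℚ) + (1ℚ * 1ℚ) * a ≡ a
  lead₂ = solve-∀ ℚ-ring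

antiderivFromᴶ : ℕ → List Jet → List Jet
antiderivFromᴶ d []      = []
antiderivFromᴶ d (c ∷ p) = constᴶ (ℤ.+ 1 ℚ./ suc d) *ᴶ c ∷ antiderivFromᴶ (suc d) p

antiderivᴶ : List Jet → List Jet
antiderivᴶ p = 0ᴶ ∷ antiderivFromᴶ 0 p

π₀-antiderivᴶ : ∀ p → π₀ (antiderivᴶ p) ≡ antiderivℚ (π₀ p)
π₀-antiderivᴶ p = cong (0ℚ ∷_) (go 0 p)
  where
  go : ∀ d p → π₀ (antiderivFromᴶ d p) ≡ antiderivFromℚ d (π₀ p)
  go d []      = refl
  go d (c ∷ p) = cong (_ ∷_) (go (suc d) p)

π₁-antiderivᴶ : ∀ p → π₁ (antiderivᴶ p) ≡ antiderivℚ (π₁ p)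
π₁-antiderivᴶ p = cong (0ℚ ∷_) (go 0 p)
  where
  lead : ∀ r a b → 0ℚ * a + r * b ≡ r * b
  lead = solve-∀ ℚ-ring
  go : ∀ d p → π₁ (antiderivFromᴶ d p) ≡ antiderivFromℚ d (π₁ p)
  go d []      = refl
  go d (c ∷ p) = cong₂ _∷_ (lead (ℤ.+ 1 ℚ./ suc d) (j₀ c) (j₁ c)) (go (suc d) p)

π₂-antiderivᴶ : ∀ p → π₂ (antiderivᴶ p) ≡ antiderivℚ (π₂ p)
π₂-antiderivᴶ p = cong (0ℚ ∷_) (go 0 p)
  where
  lead : ∀ r a b c → (0ℚ * a + 0ℚ * b) + (0ℚ * b + r * c) ≡ r * c
  lead = solve-∀ ℚ-ring
  go : ∀ d p → π₂ (antiderivFromᴶ d p) ≡ antiderivFromℚ d (π₂ p)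
  go d []      = refl
  go d (c ∷ p) = cong₂ _∷_ (lead (ℤ.+ 1 ℚ./ suc d) (j₀ c) (j₁ c) (j₂ c)) (go (suc d) p)

⟦antiderivᴶ⟧-chain-rule : ∀ p s δ → ⟦ antiderivᴶ p ⟧ᴶ (jet s δ 0ℚ) ≡
  jet (⟦ antiderivℚ (π₀ p) ⟧ s) (⟦ antiderivℚ (π₁ p) ⟧ s + δ * ⟦ π₀ p ⟧ s)
      ((⟦ antiderivℚ (π₂ p) ⟧ s + (δ + δ) * ⟦ π₁ p ⟧ s) + (δ * δ) * ⟦ D (π₀ p) ⟧ s)
⟦antiderivᴶ⟧-chain-rule p s δ = trans (⟦⟧ᴶ-chain-rule (antiderivᴶ p) s δ) (jet-cong
  (cong (λ q → ⟦ q ⟧ s) (π₀-antiderivᴶ p))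
  (cong₂ (λ u v → u + δ * v) (cong (λ q → ⟦ q ⟧ s) (π₁-antiderivᴶ p)) D∫₀)
  (cong₃ (λ u v w → (u + (δ + δ) * v) + (δ * δ) * w)
         (cong (λ q → ⟦ q ⟧ s) (π₂-antiderivᴶ p))
         (trans (cong (λ q → ⟦ D q ⟧ s) (π₁-antiderivᴶ p)) (⟦D∘antiderivℚ⟧ (π₁ p) s))
         DD∫₀))
  where
  D∫₀ : ⟦ D (π₀ (antiderivᴶ p)) ⟧ s ≡ ⟦ π₀ p ⟧ s
  D∫₀ = trans (cong (λ q → ⟦ D q ⟧ s) (π₀-antiderivᴶ p)) (⟦D∘antiderivℚ⟧ (π₀ p) s)
  DD∫₀ : ⟦ D (D (π₀ (antiderivᴶ p))) ⟧ s ≡ ⟦ D (π₀ p) ⟧ s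
  DD∫₀ = trans (cong (λ q → ⟦ D (D q) ⟧ s) (π₀-antiderivᴶ p))
               (⟦D⟧-cong (D (antiderivℚ (π₀ p))) (π₀ p) (⟦D∘antiderivℚ⟧ (π₀ p)) s)

-- Differentiating ∫_a^b with moving endpoints (Leibniz's integral rule), to second order.
integral-leibniz : ∀ p a b δa δb →
  ⟦ antiderivᴶ p ⟧ᴶ (jet b δb 0ℚ) +ᴶ constᴶ (- 1ℚ) *ᴶ ⟦ antiderivᴶ p ⟧ᴶ (jet a δa 0ℚ) ≡
  jet (integral a b (π₀ p))
      (integral a b (π₁ p) + (δb * ⟦ π₀ p ⟧ b - δa * ⟦ π₀ p ⟧ a))
      (integral a b (π₂ p) + (((δb + δb) * ⟦ π₁ p ⟧ b + (δb * δb) * ⟦ D (π₀ p) ⟧ b)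
                            - ((δa + δa) * ⟦ π₁ p ⟧ a + (δa * δa) * ⟦ D (π₀ p) ⟧ a)))
integral-leibniz p a b δa δb =
  trans (cong₂ (λ X Y → X +ᴶ constᴶ (- 1ℚ) *ᴶ Y) (⟦antiderivᴶ⟧-chain-rule p b δb) (⟦antiderivᴶ⟧-chain-rule p a δa)) (jet-cong
           (x+[-1]*y≡x-y (⟦ antiderivℚ (π₀ p) ⟧ b) (⟦ antiderivℚ (π₀ p) ⟧ a))
           (regroup₁ (⟦ antiderivℚ (π₁ p) ⟧ b) δb (⟦ π₀ p ⟧ b) (⟦ antiderivℚ (π₀ p) ⟧ a)
                     (⟦ antiderivℚ (π₁ p) ⟧ a) δa (⟦ π₀ p ⟧ a))
           (regroup₂ (⟦ antiderivℚ (π₂ p) ⟧ b) δb (⟦ π₁ p ⟧ b) (⟦ D (π₀ p) ⟧ b) (⟦ antiderivℚ (π₀ p) ⟧ a)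
                     (⟦ antiderivℚ (π₁ p) ⟧ a + δa * ⟦ π₀ p ⟧ a) (⟦ antiderivℚ (π₂ p) ⟧ a) δa
                     (⟦ π₁ p ⟧ a) (⟦ D (π₀ p) ⟧ a)))
  where
  regroup₁ : ∀ A d B Z A′ e B′ → (A + d * B) + (0ℚ * Z + (- 1ℚ) * (A′ + e * B′)) ≡ (A - A′) + (d * B - e * B′)
  regroup₁ = solve-∀ ℚ-ring
  regroup₂ : ∀ A d B C Z Y A′ e B′ C′ →
    ((A + (d + d) * B) + (d * d) * C) + ((0ℚ * Z + 0ℚ * Y) + (0ℚ * Y + (- 1ℚ) * ((A′ + (e + e) * B′) + (e * e) * C′)))
    ≡ (A - A′) + (((d + d) * B + (d * d) * C) - ((e + e) * B′ + (e * e) * C′))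
  regroup₂ = solve-∀ ℚ-ring

powᴶ : Jet → ℕ → Jet
powᴶ y zero    = 1ᴶ
powᴶ y (suc m) = y *ᴶ powᴶ y m

prodᴶ : (N : ℕ) → (Fin N → Jet) → Jet
prodᴶ zero    f = 1ᴶ
prodᴶ (suc N) f = f zero *ᴶ prodᴶ N (λ i → f (suc i))

prodᴶ-cong : ∀ N {f g : Fin N → Jet} → (∀ i → f i ≡ g i) → prodᴶ N f ≡ prodᴶ N g
prodᴶ-cong zero    f≗g = refl
prodᴶ-cong (suc N) f≗g = cong₂ _*ᴶ_ (f≗g zero) (prodᴶ-cong N (λ i → f≗g (suc i)))

module Homomorphic {N : ℕ} (φ : Expr N → Jet)
  (φ-⊕ : ∀ a b → φ (a ⊕ b) ≡ φ a +ᴶ φ b)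
  (φ-⊗ : ∀ a b → φ (a ⊗ b) ≡ φ a *ᴶ φ b)
  (φ-con : ∀ q → φ (con q) ≡ constᴶ q) where

  ⟦_⟧φ : TPoly N → Jet → Jet
  ⟦ p ⟧φ y = ⟦ map φ p ⟧ᴶ y

  ⟦⟧φ-addT : ∀ p q y → ⟦ addT p q ⟧φ y ≡ ⟦ p ⟧φ y +ᴶ ⟦ q ⟧φ y
  ⟦⟧φ-addT []      q       y = sym (+ᴶ-identityˡ (⟦ q ⟧φ y))
  ⟦⟧φ-addT (a ∷ p) []      y = sym (+ᴶ-identityʳ (⟦ a ∷ p ⟧φ y))
  ⟦⟧φ-addT (a ∷ p) (b ∷ q) y =
    trans (cong₂ (λ u v → u +ᴶ y *ᴶ v) (φ-⊕ a b) (⟦⟧φ-addT p q y)) (regroup (φ a) (φ b) y (⟦ p ⟧φ y) (⟦ q ⟧φ y))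
    where
    regroup : ∀ a b y x z → (a +ᴶ b) +ᴶ y *ᴶ (x +ᴶ z) ≡ (a +ᴶ y *ᴶ x) +ᴶ (b +ᴶ y *ᴶ z)
    regroup = solve-∀ Jet-ring

  ⟦⟧φ-scaleT : ∀ c p y → ⟦ scaleT c p ⟧φ y ≡ φ c *ᴶ ⟦ p ⟧φ y
  ⟦⟧φ-scaleT c []      y = sym (c*0≡0 (φ c))
    where
    c*0≡0 : ∀ c → c *ᴶ 0ᴶ ≡ 0ᴶ
    c*0≡0 = solve-∀ Jet-ring
  ⟦⟧φ-scaleT c (a ∷ p) y =
    trans (cong₂ (λ u v → u +ᴶ y *ᴶ v) (φ-⊗ c a) (⟦⟧φ-scaleT c p y)) (regroup (φ c) (φ a) y (⟦ p ⟧φ y))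
    where
    regroup : ∀ c a y x → c *ᴶ a +ᴶ y *ᴶ (c *ᴶ x) ≡ c *ᴶ (a +ᴶ y *ᴶ x)
    regroup = solve-∀ Jet-ring

  ⟦⟧φ-mulT : ∀ p q y → ⟦ mulT p q ⟧φ y ≡ ⟦ p ⟧φ y *ᴶ ⟦ q ⟧φ y
  ⟦⟧φ-mulT []      q y = sym (0*q≡0 (⟦ q ⟧φ y))
    where
    0*q≡0 : ∀ q → 0ᴶ *ᴶ q ≡ 0ᴶ
    0*q≡0 = solve-∀ Jet-ring
  ⟦⟧φ-mulT (a ∷ p) q y = begin
    ⟦ addT (scaleT a q) (con 0ℚ ∷ mulT p q) ⟧φ y     ≡⟨ ⟦⟧φ-addT (scaleT a q) (con 0ℚ ∷ mulT p q) y ⟩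
    ⟦ scaleT a q ⟧φ y +ᴶ (φ (con 0ℚ) +ᴶ y *ᴶ ⟦ mulT p q ⟧φ y)
      ≡⟨ cong₃ (λ u v w → u +ᴶ (v +ᴶ y *ᴶ w)) (⟦⟧φ-scaleT a q y) (φ-con 0ℚ) (⟦⟧φ-mulT p q y) ⟩
    φ a *ᴶ ⟦ q ⟧φ y +ᴶ (0ᴶ +ᴶ y *ᴶ (⟦ p ⟧φ y *ᴶ ⟦ q ⟧φ y)) ≡⟨ regroup (φ a) (⟦ p ⟧φ y) y (⟦ q ⟧φ y) ⟩
    (φ a +ᴶ y *ᴶ ⟦ p ⟧φ y) *ᴶ ⟦ q ⟧φ y               ∎
    where
    regroup : ∀ a x y z → a *ᴶ z +ᴶ (0ᴶ +ᴶ y *ᴶ (x *ᴶ z)) ≡ (a +ᴶ y *ᴶ x) *ᴶ z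
    regroup = solve-∀ Jet-ring

  ⟦⟧φ-one : ∀ y → ⟦ con 1ℚ ∷ [] ⟧φ y ≡ 1ᴶ
  ⟦⟧φ-one y = trans (cong (λ u → u +ᴶ y *ᴶ 0ᴶ) (φ-con 1ℚ)) (1+y*0≡1 y)
    where
    1+y*0≡1 : ∀ y → 1ᴶ +ᴶ y *ᴶ 0ᴶ ≡ 1ᴶ
    1+y*0≡1 = solve-∀ Jet-ring

  ⟦⟧φ-powT : ∀ p m y → ⟦ powT p m ⟧φ y ≡ powᴶ (⟦ p ⟧φ y) m
  ⟦⟧φ-powT p zero    y = ⟦⟧φ-one y
  ⟦⟧φ-powT p (suc m) y = trans (⟦⟧φ-mulT p (powT p m) y) (cong (⟦ p ⟧φ y *ᴶ_) (⟦⟧φ-powT p m y))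

  ⟦⟧φ-tPow : ∀ k y → ⟦ tPow k ⟧φ y ≡ powᴶ y k
  ⟦⟧φ-tPow zero    y = ⟦⟧φ-one y
  ⟦⟧φ-tPow (suc k) y =
    trans (cong₂ (λ u v → u +ᴶ y *ᴶ v) (φ-con 0ℚ) (⟦⟧φ-tPow k y)) (+ᴶ-identityˡ (y *ᴶ powᴶ y k))

  ⟦⟧φ-prodT : ∀ M (f : Fin M → TPoly N) y → ⟦ prodT M f ⟧φ y ≡ prodᴶ M (λ i → ⟦ f i ⟧φ y)
  ⟦⟧φ-prodT zero    f y = ⟦⟧φ-one y
  ⟦⟧φ-prodT (suc M) f y = trans (⟦⟧φ-mulT (f zero) (prodT M (λ i → f (suc i))) y)
                                (cong (⟦ f zero ⟧φ y *ᴶ_) (⟦⟧φ-prodT M (λ i → f (suc i)) y))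

  φ-substT : ∀ p e → φ (substT p e) ≡ ⟦ p ⟧φ (φ e)
  φ-substT []      e = φ-con 0ℚ
  φ-substT (a ∷ p) e =
    trans (φ-⊕ a (e ⊗ substT p e)) (cong (φ a +ᴶ_) (trans (φ-⊗ e (substT p e)) (cong (φ e *ᴶ_) (φ-substT p e))))

  map-φ-antideriv : ∀ p → map φ (antideriv p) ≡ antiderivᴶ (map φ p)
  map-φ-antideriv p = cong₂ _∷_ (φ-con 0ℚ) (go 0 p)
    where
    go : ∀ d p → map φ (antiderivFrom d p) ≡ antiderivFromᴶ d (map φ p)
    go d []      = refl
    go d (a ∷ p) = cong₂ _∷_ (trans (φ-⊗ (con _) a) (cong (_*ᴶ φ a) (φ-con _))) (go (suc d) p)

-- A ↦ Aᵐ and its first two derivatives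

power power′ power″ : ℕ → ℚ → ℚ
power  zero    A = 1ℚ
power  (suc m) A = A * power m A
power′ zero    A = 0ℚ
power′ (suc m) A = power m A + A * power′ m A
power″ zero    A = 0ℚ
power″ (suc m) A = (power′ m A + power′ m A) + A * power″ m A

powᴶ-linear : ∀ A b m → powᴶ (jet A b 0ℚ) m ≡ jet (power m A) (b * power′ m A) ((b * b) * power″ m A)
powᴶ-linear A b zero    = jet-cong refl (sym (ℚₚ.*-zeroʳ b)) (sym (ℚₚ.*-zeroʳ (b * b)))
powᴶ-linear A b (suc m) = trans (cong (jet A b 0ℚ *ᴶ_) (powᴶ-linear A b m))
  (jet-cong refl (first A b (power m A) (power′ m A)) (second A b (power m A) (power′ m A) (power″ m A)))
  where
  first : ∀ A b u v → b * u + A * (b * v) ≡ b * (u + A * v)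
  first = solve-∀ ℚ-ring
  second : ∀ A b u v w → (0ℚ * u + b * (b * v)) + (b * (b * v) + A * ((b * b) * w)) ≡ (b * b) * ((v + v) + A * w)
  second = solve-∀ ℚ-ring

power′-suc : ∀ m A → power′ (suc m) A ≡ ℕ→ℚ (suc m) * power m A
power′-suc zero    A = trans (cong (1ℚ +_) (ℚₚ.*-zeroʳ A)) refl
power′-suc (suc m) A = begin
  A * power m A + A * power′ (suc m) A        ≡⟨ cong (λ z → A * power m A + A * z) (power′-suc m A) ⟩
  A * power m A + A * (ℕ→ℚ (suc m) * power m A) ≡⟨ regroup A (power m A) (ℕ→ℚ (suc m)) ⟩
  (1ℚ + ℕ→ℚ (suc m)) * (A * power m A)        ≡⟨ cong (_* (A * power m A)) (sym (ℕ→ℚ-suc (suc m))) ⟩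
  ℕ→ℚ (suc (suc m)) * (A * power m A)         ∎
  where
  regroup : ∀ A u n → A * u + A * (n * u) ≡ (1ℚ + n) * (A * u)
  regroup = solve-∀ ℚ-ring

power″-suc-suc : ∀ m A → power″ (suc (suc m)) A ≡ ℕ→ℚ (suc (suc m)) * (ℕ→ℚ (suc m) * power m A)
power″-suc-suc zero A = begin
  (power′ 1 A + power′ 1 A) + A * power″ 1 A ≡⟨ cong₂ (λ u v → (u + u) + A * v) (power′-suc 0 A) power″-1 ⟩
  (1ℚ * 1ℚ + 1ℚ * 1ℚ) + A * 0ℚ              ≡⟨ cong ((1ℚ * 1ℚ + 1ℚ * 1ℚ) +_) (ℚₚ.*-zeroʳ A) ⟩
  ℕ→ℚ 2 * (ℕ→ℚ 1 * 1ℚ)                      ∎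
  where
  power″-1 : power″ 1 A ≡ 0ℚ
  power″-1 = trans (cong₂ _+_ (ℚₚ.+-identityˡ 0ℚ) (ℚₚ.*-zeroʳ A)) (ℚₚ.+-identityˡ 0ℚ)
power″-suc-suc (suc m) A = begin
  (power′ (suc (suc m)) A + power′ (suc (suc m)) A) + A * power″ (suc (suc m)) A
    ≡⟨ cong₂ (λ u v → (u + u) + A * v) (power′-suc (suc m) A) (power″-suc-suc m A) ⟩
  (n₂ * (A * power m A) + n₂ * (A * power m A)) + A * (n₂ * (n₁ * power m A))
    ≡⟨ regroup n₁ n₂ A (power m A) ⟩
  (n₂ + n₂ + n₂ * n₁) * (A * power m A)  ≡⟨ cong (_* (A * power m A)) coefficient ⟩
  n₃ * n₂ * (A * power m A)              ≡⟨ ℚₚ.*-assoc n₃ n₂ (A * power m A) ⟩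
  n₃ * (n₂ * (A * power m A))            ∎
  where
  n₁ = ℕ→ℚ (suc m)
  n₂ = ℕ→ℚ (suc (suc m))
  n₃ = ℕ→ℚ (suc (suc (suc m)))
  regroup : ∀ n₁ n₂ A u → (n₂ * (A * u) + n₂ * (A * u)) + A * (n₂ * (n₁ * u)) ≡ (n₂ + n₂ + n₂ * n₁) * (A * u)
  regroup = solve-∀ ℚ-ring
  arith : ∀ a b → a + a + a * (1ℚ + b) ≡ (1ℚ + (1ℚ + (1ℚ + b))) * a
  arith = solve-∀ ℚ-ring
  coefficient : n₂ + n₂ + n₂ * n₁ ≡ n₃ * n₂
  coefficient = begin
    n₂ + n₂ + n₂ * n₁                        ≡⟨ cong (λ z → n₂ + n₂ + n₂ * z) (ℕ→ℚ-suc m) ⟩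
    n₂ + n₂ + n₂ * (1ℚ + ℕ→ℚ m)              ≡⟨ arith n₂ (ℕ→ℚ m) ⟩
    (1ℚ + (1ℚ + (1ℚ + ℕ→ℚ m))) * n₂
      ≡⟨ cong (_* n₂) (sym (trans (ℕ→ℚ-suc (suc (suc m))) (cong (1ℚ +_) (trans (ℕ→ℚ-suc (suc m))
                                                                    (cong (1ℚ +_) (ℕ→ℚ-suc m)))))) ⟩
    n₃ * n₂                                  ∎

power′-closed : ∀ k A → power′ k A ≡ ℕ→ℚ k * power (k ℕ.∸ 1) A
power′-closed zero    A = sym (ℚₚ.*-zeroˡ 1ℚ)
power′-closed (suc k) A = power′-suc k A

power′-pred-closed : ∀ k A → power′ (k ℕ.∸ 1) A ≡ ℕ→ℚ (k ℕ.∸ 1) * power (k ℕ.∸ 2) A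
power′-pred-closed zero    A = sym (ℚₚ.*-zeroˡ 1ℚ)
power′-pred-closed (suc k) A = power′-closed k A

power″-closed : ∀ k A → power″ k A ≡ ℕ→ℚ k * (ℕ→ℚ (k ℕ.∸ 1) * power (k ℕ.∸ 2) A)
power″-closed zero          A = sym (ℚₚ.*-zeroˡ (ℕ→ℚ 0 * power 0 A))
power″-closed (suc zero)    A =
  trans (trans (cong₂ _+_ (ℚₚ.+-identityˡ 0ℚ) (ℚₚ.*-zeroʳ A)) (ℚₚ.+-identityˡ 0ℚ))
        (sym (trans (cong (1ℚ *_) (ℚₚ.*-zeroˡ 1ℚ)) (ℚₚ.*-zeroʳ 1ℚ)))
power″-closed (suc (suc k)) A = power″-suc-suc k A

power-wronskian : ∀ m A B →
  ℕ→ℚ m * (power′ m A * power m B - power m A * power′ m B) ≡ (B - A) * (power′ m A * power′ m B)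
power-wronskian zero    A B = trans (ℚₚ.*-zeroˡ (power′ 0 A * power 0 B - power 0 A * power′ 0 B)) (sym (trans (cong ((B - A) *_) (ℚₚ.*-zeroˡ 0ℚ)) (ℚₚ.*-zeroʳ (B - A))))
power-wronskian (suc m) A B rewrite power′-suc m A | power′-suc m B =
  identity (ℕ→ℚ (suc m)) (power m A) (power m B) A B
  where
  identity : ∀ n a b A B → n * ((n * a) * (B * b) - (A * a) * (n * b)) ≡ (B - A) * ((n * a) * (n * b))
  identity = solve-∀ ℚ-ring

power-0*power′≡0 : ∀ m A → power m 0ℚ * power′ m A ≡ 0ℚ
power-0*power′≡0 zero    A = ℚₚ.*-zeroʳ 1ℚ
power-0*power′≡0 (suc m) A = trans (cong (_* power′ (suc m) A) (ℚₚ.*-zeroˡ (power m 0ℚ))) (ℚₚ.*-zeroˡ (power′ (suc m) A))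

m*power-m-0≡0 : ∀ m Z → ℕ→ℚ m * (power m 0ℚ * Z) ≡ 0ℚ
m*power-m-0≡0 zero    Z = ℚₚ.*-zeroˡ (1ℚ * Z)
m*power-m-0≡0 (suc m) Z =
  trans (cong (ℕ→ℚ (suc m) *_) (trans (cong (_* Z) (ℚₚ.*-zeroˡ (power m 0ℚ))) (ℚₚ.*-zeroˡ Z)))
        (ℚₚ.*-zeroʳ (ℕ→ℚ (suc m)))

power-leibniz : ∀ k s P₀ P₁ P₂ →
  ((power″ k s * P₀ + power′ k s * P₁) + (power′ k s * P₁ + power k s * P₂))
  - ℕ→ℚ (2 ℕ.* k) * (power′ (k ℕ.∸ 1) s * P₀ + power (k ℕ.∸ 1) s * P₁)
  + ℕ→ℚ (k ℕ.* (k ℕ.∸ 1)) * (power (k ℕ.∸ 2) s * P₀)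
  ≡ power k s * P₂
power-leibniz k s P₀ P₁ P₂
  rewrite power″-closed k s | power′-closed k s | power′-pred-closed k s
        | ℕ→ℚ-double k | ℕ→ℚ-* k (k ℕ.∸ 1) =
  by-ring (ℕ→ℚ k) (ℕ→ℚ (k ℕ.∸ 1)) (power k s) (power (k ℕ.∸ 1) s) (power (k ℕ.∸ 2) s) P₀ P₁ P₂
  where
  by-ring : ∀ n n₁ u u₁ u₂ P₀ P₁ P₂ →
    (((n * (n₁ * u₂)) * P₀ + (n * u₁) * P₁) + ((n * u₁) * P₁ + u * P₂))
    - ((1ℚ + 1ℚ) * n) * ((n₁ * u₂) * P₀ + u₁ * P₁) + (n * n₁) * (u₂ * P₀) ≡ u * P₂
  by-ring = solve-∀ ℚ-ring

-- Jets of P(t) = ∏ₗ (t − xₗ)ᵐ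

constᴶ-*ᴶ : ∀ a X → constᴶ a *ᴶ X ≡ jet (a * j₀ X) (a * j₁ X) (a * j₂ X)
constᴶ-*ᴶ a X = jet-cong refl (first a (j₀ X) (j₁ X)) (second a (j₀ X) (j₁ X) (j₂ X))
  where
  first : ∀ a u v → 0ℚ * u + a * v ≡ a * v
  first = solve-∀ ℚ-ring
  second : ∀ a u v w → (0ℚ * u + 0ℚ * v) + (0ℚ * v + a * w) ≡ a * w
  second = solve-∀ ℚ-ring

-- A factor whose value, t-derivative and second t-derivative are a, b, c; its derivatives in the
-- direction xᵢ are −e b and e c with e = δ i l (then e² = e).
xfactor : ℚ → ℚ → ℚ → ℚ → Jet
xfactor e a b c = jet a (- (e * b)) (e * c)

xfactor-0 : ∀ a b c → xfactor 0ℚ a b c ≡ constᴶ a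
xfactor-0 a b c = jet-cong refl (cong -_ (ℚₚ.*-zeroˡ b)) (ℚₚ.*-zeroˡ c)

module Product (m : ℕ) (s : ℚ) where

  f f′ f″ : ∀ {N} → (Fin N → ℚ) → Fin N → ℚ
  f  x l = power  m (s - x l)
  f′ x l = power′ m (s - x l)
  f″ x l = power″ m (s - x l)

  jetₜ : ∀ N → (Fin N → ℚ) → Jet
  jetₜ N x = prodᴶ N (λ l → jet (f x l) (f′ x l) (f″ x l))

  jetₓ : ∀ N → (Fin N → ℚ) → Fin N → Jet
  jetₓ N x i = prodᴶ N (λ l → xfactor (δ i l) (f x l) (f′ x l) (f″ x l))

  prod-xfactor-0 : ∀ N x → prodᴶ N (λ l → xfactor 0ℚ (f x l) (f′ x l) (f″ x l)) ≡ constᴶ (j₀ (jetₜ N x))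
  prod-xfactor-0 zero    x = refl
  prod-xfactor-0 (suc N) x =
    trans (cong₂ _*ᴶ_ (xfactor-0 (f x zero) (f′ x zero) (f″ x zero)) (prod-xfactor-0 N (λ i → x (suc i))))
          (trans (constᴶ-*ᴶ (f x zero) (constᴶ P))
                 (jet-cong refl (ℚₚ.*-zeroʳ (f x zero)) (ℚₚ.*-zeroʳ (f x zero))))
    where P = j₀ (jetₜ N (λ i → x (suc i)))

  jetₓ-zero : ∀ N x → jetₓ (suc N) x zero
                    ≡ xfactor 1ℚ (f x zero) (f′ x zero) (f″ x zero) *ᴶ constᴶ (j₀ (jetₜ N (λ i → x (suc i))))
  jetₓ-zero N x = cong (xfactor 1ℚ (f x zero) (f′ x zero) (f″ x zero) *ᴶ_) (prod-xfactor-0 N (λ i → x (suc i)))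

  jetₓ-suc : ∀ N x i → jetₓ (suc N) x (suc i) ≡ jet (f x zero * j₀ (jetₓ N (λ l → x (suc l)) i))
                                                     (f x zero * j₁ (jetₓ N (λ l → x (suc l)) i))
                                                     (f x zero * j₂ (jetₓ N (λ l → x (suc l)) i))
  jetₓ-suc N x i = trans (cong (_*ᴶ jetₓ N (λ l → x (suc l)) i) (xfactor-0 (f x zero) (f′ x zero) (f″ x zero)))
                         (constᴶ-*ᴶ (f x zero) (jetₓ N (λ l → x (suc l)) i))

  j₁-jetₓ-zero : ∀ N x → j₁ (jetₓ (suc N) x zero) ≡ - (f′ x zero * j₀ (jetₜ N (λ i → x (suc i))))
  j₁-jetₓ-zero N x = trans (cong j₁ (jetₓ-zero N x)) (simplify (f′ x zero) (j₀ (jetₜ N (λ i → x (suc i)))) (f x zero))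
    where
    simplify : ∀ v P u → (- (1ℚ * v)) * P + u * 0ℚ ≡ - (v * P)
    simplify = solve-∀ ℚ-ring

  j₂-jetₓ-zero : ∀ N x → j₂ (jetₓ (suc N) x zero) ≡ f″ x zero * j₀ (jetₜ N (λ i → x (suc i)))
  j₂-jetₓ-zero N x =
    trans (cong j₂ (jetₓ-zero N x)) (simplify (f″ x zero) (f′ x zero) (j₀ (jetₜ N (λ i → x (suc i)))) (f x zero))
    where
    simplify : ∀ w v P u → ((1ℚ * w) * P + (- (1ℚ * v)) * 0ℚ) + ((- (1ℚ * v)) * 0ℚ + u * 0ℚ) ≡ w * P
    simplify = solve-∀ ℚ-ring

  -- Z is the product of the factors other than the i-th.
  factor-out : ∀ N x i → Σ ℚ (λ Z → (j₁ (jetₓ N x i) ≡ - (f′ x i * Z)) × (j₀ (jetₜ N x) ≡ f x i * Z))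
  factor-out (suc N) x zero    = j₀ (jetₜ N (λ i → x (suc i))) , j₁-jetₓ-zero N x , refl
  factor-out (suc N) x (suc i) with factor-out N (λ l → x (suc l)) i
  ... | Z , ∂ᵢP≡ , P≡ =
    f x zero * Z ,
    trans (cong j₁ (jetₓ-suc N x i))
          (trans (cong (f x zero *_) ∂ᵢP≡) (pull₁ (f x zero) (f′ x (suc i)) Z)) ,
    trans (cong (f x zero *_) P≡) (pull₂ (f x zero) (f x (suc i)) Z)
    where
    pull₁ : ∀ a v Z → a * (- (v * Z)) ≡ - (v * (a * Z))
    pull₁ = solve-∀ ℚ-ring
    pull₂ : ∀ a b Z → a * (b * Z) ≡ b * (a * Z)
    pull₂ = solve-∀ ℚ-ring

  sum-j₁-jetₓ : ∀ N x → sumFin N (λ i → j₁ (jetₓ N x i)) ≡ - j₁ (jetₜ N x)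
  sum-j₁-jetₓ zero    x = refl
  sum-j₁-jetₓ (suc N) x = begin
    j₁ (jetₓ (suc N) x zero) + sumFin N (λ i → j₁ (jetₓ (suc N) x (suc i)))
      ≡⟨ cong₂ _+_ (j₁-jetₓ-zero N x) (sumFin-cong N (λ i → cong j₁ (jetₓ-suc N x i))) ⟩
    - (v * P) + sumFin N (λ i → u * j₁ (jetₓ N x′ i))
      ≡⟨ cong (- (v * P) +_) (trans (sumFin-* N u (λ i → j₁ (jetₓ N x′ i))) (cong (u *_) (sum-j₁-jetₓ N x′))) ⟩
    - (v * P) + u * (- j₁ (jetₜ N x′))   ≡⟨ regroup v P u (j₁ (jetₜ N x′)) ⟩
    - (v * P + u * j₁ (jetₜ N x′))       ∎
    where
    x′ = λ i → x (suc i)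
    u = f x zero
    v = f′ x zero
    P = j₀ (jetₜ N x′)
    regroup : ∀ v P u V → - (v * P) + u * (- V) ≡ - (v * P + u * V)
    regroup = solve-∀ ℚ-ring

  sum-j₂-jetₓ-suc : ∀ N x → sumFin (suc N) (λ i → j₂ (jetₓ (suc N) x i))
                          ≡ f″ x zero * j₀ (jetₜ N (λ i → x (suc i)))
                            + f x zero * sumFin N (λ i → j₂ (jetₓ N (λ l → x (suc l)) i))
  sum-j₂-jetₓ-suc N x =
    cong₂ _+_ (j₂-jetₓ-zero N x)
              (trans (sumFin-cong N (λ i → cong j₂ (jetₓ-suc N x i)))
                     (sumFin-* N (f x zero) (λ i → j₂ (jetₓ N (λ l → x (suc l)) i))))

  pairSum-j₁-jetₓ-suc : ∀ N x →
    pairSum (suc N) x (λ i → j₁ (jetₓ (suc N) x i))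
    ≡ sumFin N (λ l → inv (x zero - x (suc l)) * (j₁ (jetₓ (suc N) x zero) - j₁ (jetₓ (suc N) x (suc l))))
      + f x zero * pairSum N (λ i → x (suc i)) (λ i → j₁ (jetₓ N (λ l → x (suc l)) i))
  pairSum-j₁-jetₓ-suc N x =
    trans (pairSum-suc N x (λ i → j₁ (jetₓ (suc N) x i)))
          (cong (sumFin N (λ l → inv (x zero - x (suc l)) * (j₁ (jetₓ (suc N) x zero) - j₁ (jetₓ (suc N) x (suc l)))) +_)
                (trans (pairSum-cong N x′ (λ i → cong j₁ (jetₓ-suc N x i)))
                              (pairSum-* N x′ (f x zero) (λ i → j₁ (jetₓ N x′ i)))))
    where x′ = λ i → x (suc i)

  -- The Wronskian identity makes each first-row term of the pair sum collapse.
  pair-row : ∀ N x l → x zero ≢ x (suc l) →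
    ℕ→ℚ (2 ℕ.* m) * (inv (x zero - x (suc l)) * (j₁ (jetₓ (suc N) x zero) - j₁ (jetₓ (suc N) x (suc l))))
    ≡ (f′ x zero + f′ x zero) * j₁ (jetₓ N (λ i → x (suc i)) l)
  pair-row N x l x₀≢xₗ with factor-out N (λ i → x (suc i)) l
  ... | Z , ∂ₗP′≡ , P′≡ = begin
    ℕ→ℚ (2 ℕ.* m) * (inv d * (j₁ (jetₓ (suc N) x zero) - j₁ (jetₓ (suc N) x (suc l))))
      ≡⟨ cong₃ (λ c a b → c * (inv d * (a - b))) (ℕ→ℚ-double m)
               (trans (j₁-jetₓ-zero N x) (cong (λ z → - (v₀ * z)) P′≡))
               (trans (cong j₁ (jetₓ-suc N x l)) (cong (u₀ *_) ∂ₗP′≡)) ⟩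
    ((1ℚ + 1ℚ) * ℕ→ℚ m) * (inv d * (- (v₀ * (uₗ * Z)) - u₀ * (- (vₗ * Z))))
      ≡⟨ regroup₁ (ℕ→ℚ m) (inv d) v₀ u₀ vₗ uₗ Z ⟩
    - ((1ℚ + 1ℚ) * (inv d * (Z * (ℕ→ℚ m * (v₀ * uₗ - u₀ * vₗ)))))
      ≡⟨ cong (λ w → - ((1ℚ + 1ℚ) * (inv d * (Z * w)))) wronskian ⟩
    - ((1ℚ + 1ℚ) * (inv d * (Z * (d * (v₀ * vₗ)))))
      ≡⟨ regroup₂ (inv d) d Z v₀ vₗ ⟩
    - ((1ℚ + 1ℚ) * ((inv d * d) * (Z * (v₀ * vₗ))))
      ≡⟨ cong (λ w → - ((1ℚ + 1ℚ) * (w * (Z * (v₀ * vₗ))))) (inv-inverseˡ d (x≢y⇒x-y≢0 _ _ x₀≢xₗ)) ⟩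
    - ((1ℚ + 1ℚ) * (1ℚ * (Z * (v₀ * vₗ))))
      ≡⟨ regroup₃ Z v₀ vₗ ⟩
    (v₀ + v₀) * (- (vₗ * Z))
      ≡⟨ cong ((v₀ + v₀) *_) (sym ∂ₗP′≡) ⟩
    (v₀ + v₀) * j₁ (jetₓ N (λ i → x (suc i)) l) ∎
    where
    d = x zero - x (suc l)
    u₀ = f x zero
    v₀ = f′ x zero
    uₗ = f (λ i → x (suc i)) l
    vₗ = f′ (λ i → x (suc i)) l
    wronskian : ℕ→ℚ m * (v₀ * uₗ - u₀ * vₗ) ≡ d * (v₀ * vₗ)
    wronskian = trans (power-wronskian m (s - x zero) (s - x (suc l)))
                      (cong (_* (v₀ * vₗ)) (difference s (x zero) (x (suc l))))
      where
      difference : ∀ s a b → (s - b) - (s - a) ≡ a - b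
      difference = solve-∀ ℚ-ring
    regroup₁ : ∀ m i v₀ u₀ vₗ uₗ Z → ((1ℚ + 1ℚ) * m) * (i * (- (v₀ * (uₗ * Z)) - u₀ * (- (vₗ * Z))))
                                   ≡ - ((1ℚ + 1ℚ) * (i * (Z * (m * (v₀ * uₗ - u₀ * vₗ)))))
    regroup₁ = solve-∀ ℚ-ring
    regroup₂ : ∀ i d Z v₀ vₗ → - ((1ℚ + 1ℚ) * (i * (Z * (d * (v₀ * vₗ)))))
                             ≡ - ((1ℚ + 1ℚ) * ((i * d) * (Z * (v₀ * vₗ))))
    regroup₂ = solve-∀ ℚ-ring
    regroup₃ : ∀ Z v₀ vₗ → - ((1ℚ + 1ℚ) * (1ℚ * (Z * (v₀ * vₗ)))) ≡ (v₀ + v₀) * (- (vₗ * Z))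
    regroup₃ = solve-∀ ℚ-ring

  heat-identity : ∀ N x → (∀ i l → i ≢ l → x i ≢ x l) →
    sumFin N (λ i → j₂ (jetₓ N x i)) - ℕ→ℚ (2 ℕ.* m) * pairSum N x (λ i → j₁ (jetₓ N x i)) ≡ j₂ (jetₜ N x)
  heat-identity zero    x _   = cong (λ z → 0ℚ - z) (ℚₚ.*-zeroʳ (ℕ→ℚ (2 ℕ.* m)))
  heat-identity (suc N) x inj = begin
    sumFin (suc N) (λ i → j₂ (jetₓ (suc N) x i)) - c * pairSum (suc N) x (λ i → j₁ (jetₓ (suc N) x i))
      ≡⟨ cong₂ (λ a b → a - c * b) (sum-j₂-jetₓ-suc N x) (pairSum-j₁-jetₓ-suc N x) ⟩
    (w₀ * P′ + u₀ * Σ′) - c * (R + u₀ * PS′)   ≡⟨ regroup₁ w₀ P′ u₀ Σ′ c R PS′ ⟩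
    (w₀ * P′ + u₀ * (Σ′ - c * PS′)) - c * R
      ≡⟨ cong₂ (λ a b → (w₀ * P′ + u₀ * a) - b) (heat-identity N x′ inj′) first-row ⟩
    (w₀ * P′ + u₀ * W′) - (v₀ + v₀) * (- V′)   ≡⟨ regroup₂ w₀ P′ u₀ W′ v₀ V′ ⟩
    (w₀ * P′ + v₀ * V′) + (v₀ * V′ + u₀ * W′)  ∎
    where
    c = ℕ→ℚ (2 ℕ.* m)
    x′ = λ i → x (suc i)
    inj′ : ∀ i l → i ≢ l → x′ i ≢ x′ l
    inj′ i l i≢l = inj (suc i) (suc l) (λ eq → i≢l (Finₚ.suc-injective eq))
    u₀ = f x zero
    v₀ = f′ x zero
    w₀ = f″ x zero
    P′ = j₀ (jetₜ N x′)
    V′ = j₁ (jetₜ N x′)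
    W′ = j₂ (jetₜ N x′)
    Σ′ = sumFin N (λ i → j₂ (jetₓ N x′ i))
    PS′ = pairSum N x′ (λ i → j₁ (jetₓ N x′ i))
    g = λ i → j₁ (jetₓ (suc N) x i)
    R = sumFin N (λ l → inv (x zero - x (suc l)) * (g zero - g (suc l)))
    first-row : c * R ≡ (v₀ + v₀) * (- V′)
    first-row = begin
      c * R                                              ≡⟨ sym (sumFin-* N c _) ⟩
      sumFin N (λ l → c * (inv (x zero - x (suc l)) * (g zero - g (suc l))))
        ≡⟨ sumFin-cong N (λ l → pair-row N x l (inj zero (suc l) (λ ()))) ⟩
      sumFin N (λ l → (v₀ + v₀) * j₁ (jetₓ N x′ l))      ≡⟨ sumFin-* N (v₀ + v₀) (λ l → j₁ (jetₓ N x′ l)) ⟩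
      (v₀ + v₀) * sumFin N (λ l → j₁ (jetₓ N x′ l))      ≡⟨ cong ((v₀ + v₀) *_) (sum-j₁-jetₓ N x′) ⟩
      (v₀ + v₀) * (- V′)                                 ∎
    regroup₁ : ∀ w₀ P u₀ S c R PS → (w₀ * P + u₀ * S) - c * (R + u₀ * PS) ≡ (w₀ * P + u₀ * (S - c * PS)) - c * R
    regroup₁ = solve-∀ ℚ-ring
    regroup₂ : ∀ w₀ P u₀ W v₀ V → (w₀ * P + u₀ * W) - (v₀ + v₀) * (- V) ≡ (w₀ * P + v₀ * V) + (v₀ * V + u₀ * W)
    regroup₂ = solve-∀ ℚ-ring

  power-0*j₁-jetₜ≡0 : ∀ N x → power m 0ℚ * j₁ (jetₜ N x) ≡ 0ℚ
  power-0*j₁-jetₜ≡0 zero    x = ℚₚ.*-zeroʳ (power m 0ℚ)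
  power-0*j₁-jetₜ≡0 (suc N) x = begin
    z * (v₀ * P′ + u₀ * V′)     ≡⟨ regroup z v₀ P′ u₀ V′ ⟩
    (z * v₀) * P′ + u₀ * (z * V′)
      ≡⟨ cong₂ (λ a b → a * P′ + u₀ * b) (power-0*power′≡0 m (s - x zero)) (power-0*j₁-jetₜ≡0 N x′) ⟩
    0ℚ * P′ + u₀ * 0ℚ           ≡⟨ cong₂ _+_ (ℚₚ.*-zeroˡ P′) (ℚₚ.*-zeroʳ u₀) ⟩
    0ℚ                          ∎
    where
    z = power m 0ℚ
    x′ = λ i → x (suc i)
    u₀ = f x zero
    v₀ = f′ x zero
    P′ = j₀ (jetₜ N x′)
    V′ = j₁ (jetₜ N x′)
    regroup : ∀ z v P u V → z * (v * P + u * V) ≡ (z * v) * P + u * (z * V)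
    regroup = solve-∀ ℚ-ring

  -- At t = x_c, (∂ₜ + ∂_c) kills the c-th factor and the other terms carry the factor 0ᵐ.
  ∂ₜ+∂ᵢ≡0-at-root : ∀ N x c → s ≡ x c → j₁ (jetₜ N x) + j₁ (jetₓ N x c) ≡ 0ℚ
  ∂ₜ+∂ᵢ≡0-at-root (suc N) x zero s≡x₀ = begin
    (v₀ * P′ + u₀ * V′) + j₁ (jetₓ (suc N) x zero) ≡⟨ cong ((v₀ * P′ + u₀ * V′) +_) (j₁-jetₓ-zero N x) ⟩
    (v₀ * P′ + u₀ * V′) + - (v₀ * P′)               ≡⟨ cancel v₀ P′ u₀ V′ ⟩
    u₀ * V′                                         ≡⟨ cong (λ a → power m a * V′) (x≡y⇒x-y≡0 s≡x₀) ⟩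
    power m 0ℚ * V′                                 ≡⟨ power-0*j₁-jetₜ≡0 N x′ ⟩
    0ℚ                                              ∎
    where
    x′ = λ i → x (suc i)
    u₀ = f x zero
    v₀ = f′ x zero
    P′ = j₀ (jetₜ N x′)
    V′ = j₁ (jetₜ N x′)
    cancel : ∀ v P u V → (v * P + u * V) + - (v * P) ≡ u * V
    cancel = solve-∀ ℚ-ring
  ∂ₜ+∂ᵢ≡0-at-root (suc N) x (suc c) s≡xc with factor-out N (λ i → x (suc i)) c
  ... | Z , _ , P′≡ = begin
    (v₀ * P′ + u₀ * V′) + j₁ (jetₓ (suc N) x (suc c)) ≡⟨ cong ((v₀ * P′ + u₀ * V′) +_) (cong j₁ (jetₓ-suc N x c)) ⟩
    (v₀ * P′ + u₀ * V′) + u₀ * j₁ (jetₓ N x′ c)       ≡⟨ regroup v₀ P′ u₀ V′ (j₁ (jetₓ N x′ c)) ⟩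
    v₀ * P′ + u₀ * (V′ + j₁ (jetₓ N x′ c))
      ≡⟨ cong₂ (λ a b → v₀ * a + u₀ * b) (trans P′≡ (cong (λ a → power m a * Z) (x≡y⇒x-y≡0 s≡xc)))
                                          (∂ₜ+∂ᵢ≡0-at-root N x′ c s≡xc) ⟩
    v₀ * (power m 0ℚ * Z) + u₀ * 0ℚ                   ≡⟨ regroup₀ v₀ (power m 0ℚ) Z u₀ ⟩
    (power m 0ℚ * v₀) * Z                             ≡⟨ cong (_* Z) (power-0*power′≡0 m (s - x zero)) ⟩
    0ℚ * Z                                            ≡⟨ ℚₚ.*-zeroˡ Z ⟩
    0ℚ                                                ∎
    where
    x′ = λ i → x (suc i)
    u₀ = f x zero
    v₀ = f′ x zero
    P′ = j₀ (jetₜ N x′)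
    V′ = j₁ (jetₜ N x′)
    regroup : ∀ v P u V X → (v * P + u * V) + u * X ≡ v * P + u * (V + X)
    regroup = solve-∀ ℚ-ring
    regroup₀ : ∀ v z Z u → v * (z * Z) + u * 0ℚ ≡ (z * v) * Z
    regroup₀ = solve-∀ ℚ-ring

module Integrand {N : ℕ} (x : Fin N → ℚ) (m : ℕ) where

  open Product m

  -- ∂ obeys the Leibniz rule syntactically, so jetᵢ i is a ring homomorphism by definition.
  jetᵢ : Fin N → Expr N → Jet
  jetᵢ i e = jet (eval x e) (eval x (∂ i e)) (eval x (∂ i (∂ i e)))

  module Dir (i : Fin N) = Homomorphic (jetᵢ i) (λ _ _ → refl) (λ _ _ → refl) (λ _ → refl)

  valueᴶ : Expr N → Jet
  valueᴶ e = constᴶ (eval x e)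

  valueᴶ-⊗ : ∀ a b → valueᴶ (a ⊗ b) ≡ valueᴶ a *ᴶ valueᴶ b
  valueᴶ-⊗ a b = jet-cong refl (sym (zero₁ (eval x a) (eval x b))) (sym (zero₂ (eval x a) (eval x b)))
    where
    zero₁ : ∀ a b → 0ℚ * b + a * 0ℚ ≡ 0ℚ
    zero₁ = solve-∀ ℚ-ring
    zero₂ : ∀ a b → (0ℚ * b + 0ℚ * 0ℚ) + (0ℚ * 0ℚ + a * 0ℚ) ≡ 0ℚ
    zero₂ = solve-∀ ℚ-ring

  module Value = Homomorphic valueᴶ
    (λ a b → jet-cong refl (sym (ℚₚ.+-identityˡ 0ℚ)) (sym (ℚₚ.+-identityˡ 0ℚ))) valueᴶ-⊗ (λ _ → refl)

  jetᵢ-var : ∀ i l → jetᵢ i (var l) ≡ jet (x l) (δ i l) 0ℚ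
  jetᵢ-var i l with does (i Fin.≟ l)
  ... | true  = refl
  ... | false = refl

  G : ℕ → TPoly N
  G k = integrand N k m

  factor : Fin N → TPoly N
  factor l = con (- 1ℚ) ⊗ var l ∷ con 1ℚ ∷ []

  pow-factorᵢ : ∀ i l s → powᴶ (Dir.⟦_⟧φ i (factor l) (constᴶ s)) m ≡ xfactor (δ i l) (f s x l) (f′ s x l) (f″ s x l)
  pow-factorᵢ i l s = begin
    powᴶ (Dir.⟦_⟧φ i (factor l) (constᴶ s)) m
      ≡⟨ cong (λ v → powᴶ (constᴶ (- 1ℚ) *ᴶ v +ᴶ constᴶ s *ᴶ (1ᴶ +ᴶ constᴶ s *ᴶ 0ᴶ)) m) (jetᵢ-var i l) ⟩
    powᴶ (constᴶ (- 1ℚ) *ᴶ jet (x l) (δ i l) 0ℚ +ᴶ constᴶ s *ᴶ (1ᴶ +ᴶ constᴶ s *ᴶ 0ᴶ)) m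
      ≡⟨ cong (λ v → powᴶ v m) (jet-cong (value s (x l)) (first s (x l) (δ i l)) (second s (x l) (δ i l))) ⟩
    powᴶ (jet (s - x l) (- δ i l) 0ℚ) m
      ≡⟨ powᴶ-linear (s - x l) (- δ i l) m ⟩
    jet (f s x l) (- δ i l * f′ s x l) ((- δ i l * - δ i l) * f″ s x l)
      ≡⟨ jet-cong refl (sym (ℚₚ.neg-distribˡ-* (δ i l) (f′ s x l)))
                  (cong (_* f″ s x l) (trans (neg*neg (δ i l)) (δ*δ≡δ i l))) ⟩
    xfactor (δ i l) (f s x l) (f′ s x l) (f″ s x l) ∎
    where
    value : ∀ s a → (- 1ℚ) * a + s * (1ℚ + s * 0ℚ) ≡ s - a
    value = solve-∀ ℚ-ring
    first : ∀ s a b → (0ℚ * a + (- 1ℚ) * b) + (0ℚ * (1ℚ + s * 0ℚ) + s * (0ℚ + (0ℚ * 0ℚ + s * 0ℚ))) ≡ - b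
    first = solve-∀ ℚ-ring
    second : ∀ s a b → ((0ℚ * a + 0ℚ * b) + (0ℚ * b + (- 1ℚ) * 0ℚ)) +
             ((0ℚ * (1ℚ + s * 0ℚ) + 0ℚ * (0ℚ + (0ℚ * 0ℚ + s * 0ℚ))) +
              (0ℚ * (0ℚ + (0ℚ * 0ℚ + s * 0ℚ)) + s * (0ℚ + ((0ℚ * 0ℚ + 0ℚ * 0ℚ) + (0ℚ * 0ℚ + s * 0ℚ)))))
             ≡ 0ℚ
    second = solve-∀ ℚ-ring
    neg*neg : ∀ d → (- d) * (- d) ≡ d * d
    neg*neg = solve-∀ ℚ-ring

  pow-factorₜ : ∀ l s → powᴶ (Value.⟦ factor l ⟧φ (jet s 1ℚ 0ℚ)) m ≡ jet (f s x l) (f′ s x l) (f″ s x l)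
  pow-factorₜ l s = begin
    powᴶ (Value.⟦ factor l ⟧φ (jet s 1ℚ 0ℚ)) m
      ≡⟨ cong (λ v → powᴶ v m) (jet-cong (value s (x l)) (first s) (second s)) ⟩
    powᴶ (jet (s - x l) 1ℚ 0ℚ) m
      ≡⟨ powᴶ-linear (s - x l) 1ℚ m ⟩
    jet (f s x l) (1ℚ * f′ s x l) ((1ℚ * 1ℚ) * f″ s x l)
      ≡⟨ jet-cong refl (ℚₚ.*-identityˡ (f′ s x l)) (ℚₚ.*-identityˡ (f″ s x l)) ⟩
    jet (f s x l) (f′ s x l) (f″ s x l) ∎
    where
    value : ∀ s a → (- 1ℚ) * a + s * (1ℚ + s * 0ℚ) ≡ s - a
    value = solve-∀ ℚ-ring
    first : ∀ s → 0ℚ + (1ℚ * (1ℚ + s * 0ℚ) + s * (0ℚ + (1ℚ * 0ℚ + s * 0ℚ))) ≡ 1ℚ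
    first = solve-∀ ℚ-ring
    second : ∀ s → 0ℚ + ((0ℚ * (1ℚ + s * 0ℚ) + 1ℚ * (0ℚ + (1ℚ * 0ℚ + s * 0ℚ))) +
             (1ℚ * (0ℚ + (1ℚ * 0ℚ + s * 0ℚ)) + s * (0ℚ + ((0ℚ * 0ℚ + 1ℚ * 0ℚ) + (1ℚ * 0ℚ + s * 0ℚ))))) ≡ 0ℚ
    second = solve-∀ ℚ-ring

  integrand-jetᵢ : ∀ i k s → Dir.⟦_⟧φ i (G k) (constᴶ s) ≡ constᴶ (power k s) *ᴶ jetₓ s N x i
  integrand-jetᵢ i k s =
    trans (Dir.⟦⟧φ-mulT i (tPow k) (prodT N (λ l → powT (factor l) m)) (constᴶ s)) (cong₂ _*ᴶ_
      (trans (Dir.⟦⟧φ-tPow i k (constᴶ s))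
             (trans (powᴶ-linear s 0ℚ k)
                    (jet-cong refl (ℚₚ.*-zeroˡ (power′ k s))
                              (trans (cong (_* power″ k s) (ℚₚ.*-zeroˡ 0ℚ)) (ℚₚ.*-zeroˡ (power″ k s))))))
      (trans (Dir.⟦⟧φ-prodT i N (λ l → powT (factor l) m) (constᴶ s))
             (prodᴶ-cong N (λ l → trans (Dir.⟦⟧φ-powT i (factor l) m (constᴶ s)) (pow-factorᵢ i l s)))))

  integrand-jetₜ : ∀ k s → Value.⟦ G k ⟧φ (jet s 1ℚ 0ℚ) ≡ jet (power k s) (power′ k s) (power″ k s) *ᴶ jetₜ s N x
  integrand-jetₜ k s =
    trans (Value.⟦⟧φ-mulT (tPow k) (prodT N (λ l → powT (factor l) m)) (jet s 1ℚ 0ℚ)) (cong₂ _*ᴶ_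
      (trans (Value.⟦⟧φ-tPow k (jet s 1ℚ 0ℚ))
             (trans (powᴶ-linear s 1ℚ k)
                    (jet-cong refl (ℚₚ.*-identityˡ (power′ k s))
                              (trans (cong (_* power″ k s) (ℚₚ.*-identityˡ 1ℚ)) (ℚₚ.*-identityˡ (power″ k s))))))
      (trans (Value.⟦⟧φ-prodT N (λ l → powT (factor l) m) (jet s 1ℚ 0ℚ))
             (prodᴶ-cong N (λ l → trans (Value.⟦⟧φ-powT (factor l) m (jet s 1ℚ 0ℚ)) (pow-factorₜ l s)))))

  -- Coefficients in t of the integrand at x and of its first two derivatives in the direction xᵢ.
  g₀ : ℕ → List ℚ
  g₀ k = map (eval x) (G k)

  g₁ g₂ : Fin N → ℕ → List ℚ
  g₁ i k = π₁ (map (jetᵢ i) (G k))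
  g₂ i k = π₂ (map (jetᵢ i) (G k))

  π₀-jetᵢ : ∀ i k → π₀ (map (jetᵢ i) (G k)) ≡ g₀ k
  π₀-jetᵢ i k = sym (Listₚ.map-∘ (G k))

  ⟦g₀⟧-jet : ∀ k s → jet (⟦ g₀ k ⟧ s) (⟦ D (g₀ k) ⟧ s) (⟦ D (D (g₀ k)) ⟧ s)
                   ≡ jet (power k s) (power′ k s) (power″ k s) *ᴶ jetₜ s N x
  ⟦g₀⟧-jet k s = begin
    jet (⟦ g₀ k ⟧ s) (⟦ D (g₀ k) ⟧ s) (⟦ D (D (g₀ k)) ⟧ s) ≡⟨ sym (⟦map-constᴶ⟧ (g₀ k) s) ⟩
    ⟦ map constᴶ (g₀ k) ⟧ᴶ (jet s 1ℚ 0ℚ)                   ≡⟨ cong (λ p → ⟦ p ⟧ᴶ (jet s 1ℚ 0ℚ)) (sym (Listₚ.map-∘ (G k))) ⟩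
    Value.⟦ G k ⟧φ (jet s 1ℚ 0ℚ)                           ≡⟨ integrand-jetₜ k s ⟩
    jet (power k s) (power′ k s) (power″ k s) *ᴶ jetₜ s N x ∎

  ⟦g₁⟧ : ∀ i k s → ⟦ g₁ i k ⟧ s ≡ power k s * j₁ (jetₓ s N x i)
  ⟦g₁⟧ i k s = trans (sym (cong j₁ (⟦⟧ᴶ-const (map (jetᵢ i) (G k)) s)))
                     (cong j₁ (trans (integrand-jetᵢ i k s) (constᴶ-*ᴶ (power k s) (jetₓ s N x i))))

  ⟦g₂⟧ : ∀ i k s → ⟦ g₂ i k ⟧ s ≡ power k s * j₂ (jetₓ s N x i)
  ⟦g₂⟧ i k s = trans (sym (cong j₂ (⟦⟧ᴶ-const (map (jetᵢ i) (G k)) s)))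
                     (cong j₂ (trans (integrand-jetᵢ i k s) (constᴶ-*ᴶ (power k s) (jetₓ s N x i))))

  ⟦g₀⟧ : ∀ k s → ⟦ g₀ k ⟧ s ≡ power k s * j₀ (jetₜ s N x)
  ⟦g₀⟧ k s = cong j₀ (⟦g₀⟧-jet k s)

  -- g₀ vanishes at every xₗ unless m = 0.
  m*⟦g₀⟧[xₗ]≡0 : ∀ k l → ℕ→ℚ m * ⟦ g₀ k ⟧ (x l) ≡ 0ℚ
  m*⟦g₀⟧[xₗ]≡0 k l with factor-out (x l) N x l
  ... | Z , _ , P≡ = begin
    ℕ→ℚ m * ⟦ g₀ k ⟧ (x l)                               ≡⟨ cong (ℕ→ℚ m *_) (trans (⟦g₀⟧ k (x l)) (cong (power k (x l) *_) P≡)) ⟩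
    ℕ→ℚ m * (power k (x l) * (power m (x l - x l) * Z))  ≡⟨ swap (ℕ→ℚ m) (power k (x l)) (power m (x l - x l) * Z) ⟩
    power k (x l) * (ℕ→ℚ m * (power m (x l - x l) * Z))
      ≡⟨ cong (λ w → power k (x l) * (ℕ→ℚ m * (power m w * Z))) (ℚₚ.+-inverseʳ (x l)) ⟩
    power k (x l) * (ℕ→ℚ m * (power m 0ℚ * Z))           ≡⟨ cong (power k (x l) *_) (m*power-m-0≡0 m Z) ⟩
    power k (x l) * 0ℚ                                   ≡⟨ ℚₚ.*-zeroʳ (power k (x l)) ⟩
    0ℚ                                                   ∎
    where
    swap : ∀ a b c → a * (b * c) ≡ b * (a * c)
    swap = solve-∀ ℚ-ring

  ⟦Dg₀⟧ : ∀ k s → ⟦ D (g₀ k) ⟧ s ≡ power′ k s * j₀ (jetₜ s N x) + power k s * j₁ (jetₜ s N x)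
  ⟦Dg₀⟧ k s = cong j₁ (⟦g₀⟧-jet k s)

  ⟦DDg₀⟧ : ∀ k s → ⟦ D (D (g₀ k)) ⟧ s ≡ (power″ k s * j₀ (jetₜ s N x) + power′ k s * j₁ (jetₜ s N x))
                                        + (power′ k s * j₁ (jetₜ s N x) + power k s * j₂ (jetₜ s N x))
  ⟦DDg₀⟧ k s = cong j₂ (⟦g₀⟧-jet k s)

  Lg : ℕ → List ℚ
  Lg k = Lₚ N x (ℕ→ℚ (2 ℕ.* m)) (λ i → g₂ i k) (λ i → g₁ i k)

  ⟦Lg⟧ : (∀ i l → i ≢ l → x i ≢ x l) → ∀ k s → ⟦ Lg k ⟧ s ≡ power k s * j₂ (jetₜ s N x)
  ⟦Lg⟧ inj k s = begin
    ⟦ Lg k ⟧ s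
      ≡⟨ Linear.Λ-Lₚ (λ p → ⟦ p ⟧ s) refl (λ p q → ⟦⟧-+ₚ p q s) (λ c p → ⟦⟧-·ₚ c p s)
                     N x c (λ i → g₂ i k) (λ i → g₁ i k) ⟩
    sumFin N (λ i → ⟦ g₂ i k ⟧ s) - c * pairSum N x (λ i → ⟦ g₁ i k ⟧ s)
      ≡⟨ cong₂ (λ u v → u - c * v)
               (trans (sumFin-cong N (λ i → ⟦g₂⟧ i k s)) (sumFin-* N (power k s) (λ i → j₂ (jetₓ s N x i))))
               (trans (pairSum-cong N x (λ i → ⟦g₁⟧ i k s)) (pairSum-* N x (power k s) (λ i → j₁ (jetₓ s N x i)))) ⟩
    power k s * Σ₂ - c * (power k s * PS₁)   ≡⟨ pull (power k s) Σ₂ c PS₁ ⟩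
    power k s * (Σ₂ - c * PS₁)              ≡⟨ cong (power k s *_) (heat-identity s N x inj) ⟩
    power k s * j₂ (jetₜ s N x)             ∎
    where
    c = ℕ→ℚ (2 ℕ.* m)
    Σ₂ = sumFin N (λ i → j₂ (jetₓ s N x i))
    PS₁ = pairSum N x (λ i → j₁ (jetₓ s N x i))
    pull : ∀ u a c b → u * a - c * (u * b) ≡ u * (a - c * b)
    pull = solve-∀ ℚ-ring

  -- ∂ₜ(tᵏP) − 2k tᵏ⁻¹P, whose derivative plus k(k−1)tᵏ⁻²P is again tᵏ∂ₜ²P.
  flux : ℕ → List ℚ
  flux k = D (g₀ k) -ₚ ℕ→ℚ (2 ℕ.* k) ·ₚ g₀ (k ℕ.∸ 1)

  exact : ℕ → List ℚ
  exact k = D (flux k) +ₚ ℕ→ℚ (k ℕ.* (k ℕ.∸ 1)) ·ₚ g₀ (k ℕ.∸ 2)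

  ⟦exact⟧ : ∀ k s → ⟦ exact k ⟧ s ≡ power k s * j₂ (jetₜ s N x)
  ⟦exact⟧ k s = begin
    ⟦ exact k ⟧ s
      ≡⟨ ⟦⟧-+ₚ (D (flux k)) (kk ·ₚ g₀ (k ℕ.∸ 2)) s ⟩
    ⟦ D (flux k) ⟧ s + ⟦ kk ·ₚ g₀ (k ℕ.∸ 2) ⟧ s
      ≡⟨ cong₂ _+_ (trans (⟦D⟧-subₚ (D (g₀ k)) (c ·ₚ g₀ (k ℕ.∸ 1)) s)
                          (cong (λ z → ⟦ D (D (g₀ k)) ⟧ s - z) (⟦D⟧-·ₚ c (g₀ (k ℕ.∸ 1)) s)))
                   (⟦⟧-·ₚ kk (g₀ (k ℕ.∸ 2)) s) ⟩
    (⟦ D (D (g₀ k)) ⟧ s - c * ⟦ D (g₀ (k ℕ.∸ 1)) ⟧ s) + kk * ⟦ g₀ (k ℕ.∸ 2) ⟧ s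
      ≡⟨ cong₃ (λ u v w → (u - c * v) + kk * w) (⟦DDg₀⟧ k s) (⟦Dg₀⟧ (k ℕ.∸ 1) s) (⟦g₀⟧ (k ℕ.∸ 2) s) ⟩
    ((power″ k s * P₀ + power′ k s * P₁) + (power′ k s * P₁ + power k s * P₂))
    - c * (power′ (k ℕ.∸ 1) s * P₀ + power (k ℕ.∸ 1) s * P₁) + kk * (power (k ℕ.∸ 2) s * P₀)
      ≡⟨ power-leibniz k s P₀ P₁ P₂ ⟩
    power k s * P₂ ∎
    where
    c = ℕ→ℚ (2 ℕ.* k)
    kk = ℕ→ℚ (k ℕ.* (k ℕ.∸ 1))
    P₀ = j₀ (jetₜ s N x)
    P₁ = j₁ (jetₜ s N x)
    P₂ = j₂ (jetₜ s N x)

  boundary′ : ℕ → Fin N → ℚ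
  boundary′ k c = (⟦ g₁ c k ⟧ (x c) + ⟦ g₁ c k ⟧ (x c)) + ⟦ D (g₀ k) ⟧ (x c)

  ⟦flux⟧+boundary′≡0 : ∀ k c → ⟦ flux k ⟧ (x c) + boundary′ k c ≡ 0ℚ
  ⟦flux⟧+boundary′≡0 k c = begin
    ⟦ flux k ⟧ (x c) + boundary′ k c
      ≡⟨ cong (_+ boundary′ k c) (trans (⟦⟧-subₚ (D (g₀ k)) (ck ·ₚ g₀ (k ℕ.∸ 1)) s)
                                        (cong (λ z → ⟦ D (g₀ k) ⟧ s - z) (⟦⟧-·ₚ ck (g₀ (k ℕ.∸ 1)) s))) ⟩
    (⟦ D (g₀ k) ⟧ s - ck * ⟦ g₀ (k ℕ.∸ 1) ⟧ s) + ((⟦ g₁ c k ⟧ s + ⟦ g₁ c k ⟧ s) + ⟦ D (g₀ k) ⟧ s)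
      ≡⟨ cong₃ (λ u v w → (u - ck * v) + ((w + w) + u)) (⟦Dg₀⟧ k s) (⟦g₀⟧ (k ℕ.∸ 1) s) (⟦g₁⟧ c k s) ⟩
    ((power′ k s * P₀ + power k s * P₁) - ck * (power (k ℕ.∸ 1) s * P₀))
    + ((power k s * d + power k s * d) + (power′ k s * P₀ + power k s * P₁))
      ≡⟨ cong₂ (λ u v → ((u * P₀ + power k s * P₁) - v * (power (k ℕ.∸ 1) s * P₀))
                        + ((power k s * d + power k s * d) + (u * P₀ + power k s * P₁)))
               (power′-closed k s) (ℕ→ℚ-double k) ⟩
    ((n * power (k ℕ.∸ 1) s * P₀ + power k s * P₁) - ((1ℚ + 1ℚ) * n) * (power (k ℕ.∸ 1) s * P₀))
    + ((power k s * d + power k s * d) + (n * power (k ℕ.∸ 1) s * P₀ + power k s * P₁))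
      ≡⟨ regroup n (power k s) (power (k ℕ.∸ 1) s) P₀ P₁ d ⟩
    (1ℚ + 1ℚ) * power k s * (P₁ + d)
      ≡⟨ cong ((1ℚ + 1ℚ) * power k s *_) (∂ₜ+∂ᵢ≡0-at-root s N x c refl) ⟩
    (1ℚ + 1ℚ) * power k s * 0ℚ ≡⟨ ℚₚ.*-zeroʳ ((1ℚ + 1ℚ) * power k s) ⟩
    0ℚ ∎
    where
    s = x c
    ck = ℕ→ℚ (2 ℕ.* k)
    n = ℕ→ℚ k
    P₀ = j₀ (jetₜ s N x)
    P₁ = j₁ (jetₜ s N x)
    d = j₁ (jetₓ s N x c)
    regroup : ∀ n u u₁ P₀ P₁ d →
      ((n * u₁ * P₀ + u * P₁) - ((1ℚ + 1ℚ) * n) * (u₁ * P₀)) + ((u * d + u * d) + (n * u₁ * P₀ + u * P₁))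
      ≡ (1ℚ + 1ℚ) * u * (P₁ + d)
    regroup = solve-∀ ℚ-ring

  module Endpoints (a b : Fin N) where

    Q : ℕ → Expr N
    Q k = Qkm N a b k m

    ∫ : List ℚ → ℚ
    ∫ = integral (x a) (x b)

    boundary : Fin N → ℕ → Fin N → ℚ
    boundary i k c = (δ i c + δ i c) * ⟦ g₁ i k ⟧ (x c) + (δ i c * δ i c) * ⟦ D (g₀ k) ⟧ (x c)


    jetᵢ-Q : ∀ i k → jetᵢ i (Q k) ≡
      jet (∫ (g₀ k))
          (∫ (g₁ i k) + (δ i b * ⟦ g₀ k ⟧ (x b) - δ i a * ⟦ g₀ k ⟧ (x a)))
          (∫ (g₂ i k) + (boundary i k b - boundary i k a))
    jetᵢ-Q i k = begin
      jetᵢ i (substT F (var b)) +ᴶ constᴶ (- 1ℚ) *ᴶ jetᵢ i (substT F (var a))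
        ≡⟨ cong₂ (λ u v → u +ᴶ constᴶ (- 1ℚ) *ᴶ v) (endpoint b) (endpoint a) ⟩
      ⟦ antiderivᴶ p ⟧ᴶ (jet (x b) (δ i b) 0ℚ) +ᴶ constᴶ (- 1ℚ) *ᴶ ⟦ antiderivᴶ p ⟧ᴶ (jet (x a) (δ i a) 0ℚ)
        ≡⟨ integral-leibniz p (x a) (x b) (δ i a) (δ i b) ⟩
      jet (∫ (π₀ p))
          (∫ (g₁ i k) + (δ i b * ⟦ π₀ p ⟧ (x b) - δ i a * ⟦ π₀ p ⟧ (x a)))
          (∫ (g₂ i k) + (((δ i b + δ i b) * ⟦ g₁ i k ⟧ (x b) + (δ i b * δ i b) * ⟦ D (π₀ p) ⟧ (x b))
                       - ((δ i a + δ i a) * ⟦ g₁ i k ⟧ (x a) + (δ i a * δ i a) * ⟦ D (π₀ p) ⟧ (x a))))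
        ≡⟨ cong (λ q → jet (∫ q)
                           (∫ (g₁ i k) + (δ i b * ⟦ q ⟧ (x b) - δ i a * ⟦ q ⟧ (x a)))
                           (∫ (g₂ i k) + (((δ i b + δ i b) * ⟦ g₁ i k ⟧ (x b) + (δ i b * δ i b) * ⟦ D q ⟧ (x b))
                                        - ((δ i a + δ i a) * ⟦ g₁ i k ⟧ (x a) + (δ i a * δ i a) * ⟦ D q ⟧ (x a)))))
                (π₀-jetᵢ i k) ⟩
      jet (∫ (g₀ k))
          (∫ (g₁ i k) + (δ i b * ⟦ g₀ k ⟧ (x b) - δ i a * ⟦ g₀ k ⟧ (x a)))
          (∫ (g₂ i k) + (boundary i k b - boundary i k a)) ∎
      where
      F = antideriv (G k)
      p = map (jetᵢ i) (G k)
      endpoint : ∀ c → jetᵢ i (substT F (var c)) ≡ ⟦ antiderivᴶ p ⟧ᴶ (jet (x c) (δ i c) 0ℚ)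
      endpoint c = trans (Dir.φ-substT i F (var c)) (cong₂ ⟦_⟧ᴶ (Dir.map-φ-antideriv i (G k)) (jetᵢ-var i c))

    eval-Q : ∀ k → eval x (Q k) ≡ ∫ (g₀ k)
    eval-Q k = cong j₀ (jetᵢ-Q a k)

    sum-∂²Q : ∀ k → sumFin N (λ i → eval x (∂ i (∂ i (Q k))))
                  ≡ sumFin N (λ i → ∫ (g₂ i k)) + (boundary′ k b - boundary′ k a)
    sum-∂²Q k = begin
      sumFin N (λ i → eval x (∂ i (∂ i (Q k))))
        ≡⟨ sumFin-cong N (λ i → cong j₂ (jetᵢ-Q i k)) ⟩
      sumFin N (λ i → ∫ (g₂ i k) + (boundary i k b - boundary i k a))
        ≡⟨ sumFin-+ N (λ i → ∫ (g₂ i k)) (λ i → boundary i k b - boundary i k a) ⟩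
      sumFin N (λ i → ∫ (g₂ i k)) + sumFin N (λ i → boundary i k b - boundary i k a)
        ≡⟨ cong (sumFin N (λ i → ∫ (g₂ i k)) +_)
                (trans (sumFin-sub N (λ i → boundary i k b) (λ i → boundary i k a))
                       (cong₂ _-_ (sum-boundary b) (sum-boundary a))) ⟩
      sumFin N (λ i → ∫ (g₂ i k)) + (boundary′ k b - boundary′ k a) ∎
      where
      factor-δ : ∀ d a b → (d + d) * a + d * b ≡ d * ((a + a) + b)
      factor-δ = solve-∀ ℚ-ring
      sum-boundary : ∀ c → sumFin N (λ i → boundary i k c) ≡ boundary′ k c
      sum-boundary c =
        trans (sumFin-cong N (λ i → trans (cong (λ z → (δ i c + δ i c) * ⟦ g₁ i k ⟧ (x c) + z * ⟦ D (g₀ k) ⟧ (x c))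
                                                (δ*δ≡δ i c))
                                          (factor-δ (δ i c) (⟦ g₁ i k ⟧ (x c)) (⟦ D (g₀ k) ⟧ (x c)))))
              (sumFin-δ N c (λ i → (⟦ g₁ i k ⟧ (x c) + ⟦ g₁ i k ⟧ (x c)) + ⟦ D (g₀ k) ⟧ (x c)))

    pairSum-∂Q : ∀ k → ℕ→ℚ (2 ℕ.* m) * pairSum N x (λ i → eval x (∂ i (Q k)))
                     ≡ ℕ→ℚ (2 ℕ.* m) * pairSum N x (λ i → ∫ (g₁ i k))
    pairSum-∂Q k = begin
      c * pairSum N x (λ i → eval x (∂ i (Q k)))
        ≡⟨ cong (c *_) (trans (pairSum-cong N x (λ i → cong j₁ (jetᵢ-Q i k)))
                              (pairSum-+ N x (λ i → ∫ (g₁ i k)) e)) ⟩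
      c * (pairSum N x (λ i → ∫ (g₁ i k)) + pairSum N x e)
        ≡⟨ ℚₚ.*-distribˡ-+ c (pairSum N x (λ i → ∫ (g₁ i k))) (pairSum N x e) ⟩
      c * pairSum N x (λ i → ∫ (g₁ i k)) + c * pairSum N x e
        ≡⟨ cong (c * pairSum N x (λ i → ∫ (g₁ i k)) +_)
                (trans (sym (pairSum-* N x c e)) (trans (pairSum-cong N x c*e≡0) (pairSum-0 N x))) ⟩
      c * pairSum N x (λ i → ∫ (g₁ i k)) + 0ℚ
        ≡⟨ ℚₚ.+-identityʳ (c * pairSum N x (λ i → ∫ (g₁ i k))) ⟩
      c * pairSum N x (λ i → ∫ (g₁ i k)) ∎
      where
      c = ℕ→ℚ (2 ℕ.* m)
      e : Fin N → ℚ
      e i = δ i b * ⟦ g₀ k ⟧ (x b) - δ i a * ⟦ g₀ k ⟧ (x a)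
      regroup : ∀ t m gb ga db da → (t * m) * (db * gb - da * ga) ≡ t * (db * (m * gb) - da * (m * ga))
      regroup = solve-∀ ℚ-ring
      vanish : ∀ db da → (1ℚ + 1ℚ) * (db * 0ℚ - da * 0ℚ) ≡ 0ℚ
      vanish = solve-∀ ℚ-ring
      c*e≡0 : ∀ i → c * e i ≡ 0ℚ
      c*e≡0 i = begin
        c * e i                                    ≡⟨ cong (_* e i) (ℕ→ℚ-double m) ⟩
        ((1ℚ + 1ℚ) * ℕ→ℚ m) * e i
          ≡⟨ regroup (1ℚ + 1ℚ) (ℕ→ℚ m) (⟦ g₀ k ⟧ (x b)) (⟦ g₀ k ⟧ (x a)) (δ i b) (δ i a) ⟩
        (1ℚ + 1ℚ) * (δ i b * (ℕ→ℚ m * ⟦ g₀ k ⟧ (x b)) - δ i a * (ℕ→ℚ m * ⟦ g₀ k ⟧ (x a)))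
          ≡⟨ cong₂ (λ u v → (1ℚ + 1ℚ) * (δ i b * u - δ i a * v)) (m*⟦g₀⟧[xₗ]≡0 k b) (m*⟦g₀⟧[xₗ]≡0 k a) ⟩
        (1ℚ + 1ℚ) * (δ i b * 0ℚ - δ i a * 0ℚ)      ≡⟨ vanish (δ i b) (δ i a) ⟩
        0ℚ                                         ∎

    ∫exact : ∀ k → ∫ (exact k) ≡ (⟦ flux k ⟧ (x b) - ⟦ flux k ⟧ (x a))
                                  + ℕ→ℚ (k ℕ.* (k ℕ.∸ 1)) * eval x (Q (k ℕ.∸ 2))
    ∫exact k =
      trans (integral-+ₚ (x a) (x b) (D (flux k)) (kk ·ₚ g₀ (k ℕ.∸ 2)))
            (cong₂ _+_ (integral-D (x a) (x b) (flux k))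
                       (trans (integral-·ₚ (x a) (x b) kk (g₀ (k ℕ.∸ 2))) (cong (kk *_) (sym (eval-Q (k ℕ.∸ 2))))))
      where kk = ℕ→ℚ (k ℕ.* (k ℕ.∸ 1))

    Lm-Q : (∀ i l → i ≢ l → x i ≢ x l) → ∀ k → Lm N m (Q k) x ≡ ℕ→ℚ (k ℕ.* (k ℕ.∸ 1)) * eval x (Q (k ℕ.∸ 2))
    Lm-Q inj k = begin
      sumFin N (λ i → eval x (∂ i (∂ i (Q k)))) - c * pairSum N x (λ i → eval x (∂ i (Q k)))
        ≡⟨ cong₂ _-_ (sum-∂²Q k) (pairSum-∂Q k) ⟩
      (Σ∫g₂ + (boundary′ k b - boundary′ k a)) - c * PS∫g₁
        ≡⟨ regroup Σ∫g₂ (boundary′ k b - boundary′ k a) (c * PS∫g₁) ⟩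
      (Σ∫g₂ - c * PS∫g₁) + (boundary′ k b - boundary′ k a)
        ≡⟨ cong (_+ (boundary′ k b - boundary′ k a))
                (sym (Linear.Λ-Lₚ ∫ (integral-[] (x a) (x b)) (integral-+ₚ (x a) (x b)) (integral-·ₚ (x a) (x b))
                                   N x c (λ i → g₂ i k) (λ i → g₁ i k))) ⟩
      ∫ (Lg k) + (boundary′ k b - boundary′ k a)
        ≡⟨ cong (_+ (boundary′ k b - boundary′ k a))
                (integral-cong (x a) (x b) (Lg k) (exact k) (λ s → trans (⟦Lg⟧ inj k s) (sym (⟦exact⟧ k s)))) ⟩
      ∫ (exact k) + (boundary′ k b - boundary′ k a)
        ≡⟨ cong (_+ (boundary′ k b - boundary′ k a)) (∫exact k) ⟩
      ((⟦ flux k ⟧ (x b) - ⟦ flux k ⟧ (x a)) + kkQ) + (boundary′ k b - boundary′ k a)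
        ≡⟨ telescope (⟦ flux k ⟧ (x b)) (⟦ flux k ⟧ (x a)) (boundary′ k b) (boundary′ k a) kkQ
                     (⟦flux⟧+boundary′≡0 k b) (⟦flux⟧+boundary′≡0 k a) ⟩
      kkQ ∎
      where
      c = ℕ→ℚ (2 ℕ.* m)
      Σ∫g₂ = sumFin N (λ i → ∫ (g₂ i k))
      PS∫g₁ = pairSum N x (λ i → ∫ (g₁ i k))
      kkQ = ℕ→ℚ (k ℕ.* (k ℕ.∸ 1)) * eval x (Q (k ℕ.∸ 2))
      regroup : ∀ a e b → (a + e) - b ≡ (a - b) + e
      regroup = solve-∀ ℚ-ring
      telescope : ∀ p q r t e → p + r ≡ 0ℚ → q + t ≡ 0ℚ → ((p - q) + e) + (r - t) ≡ e
      telescope p q r t e p+r≡0 q+t≡0 = begin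
        ((p - q) + e) + (r - t)    ≡⟨ rearrange p q r t e ⟩
        ((p + r) - (q + t)) + e    ≡⟨ cong₂ (λ u v → (u - v) + e) p+r≡0 q+t≡0 ⟩
        (0ℚ - 0ℚ) + e              ≡⟨ ℚₚ.+-identityˡ e ⟩
        e                          ∎
        where
        rearrange : ∀ p q r t e → ((p - q) + e) + (r - t) ≡ ((p + r) - (q + t)) + e
        rearrange = solve-∀ ℚ-ring

theorem7p1 : (n : ℕ) → 2 ≤ suc n → (m : ℕ) → (j : Fin (suc n)) → j ≢ zero
    → (x : Fin (suc n) → ℚ) → (∀ i l → i ≢ l → x i ≢ x l)
    → ((k : ℕ) → Lm (suc n) m (Qkm (suc n) zero j (2 ℕ.+ k) m) x
                   ≡ ℕ→ℚ ((2 ℕ.+ k) ℕ.* (1 ℕ.+ k)) * eval x (Qkm (suc n) zero j k m))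
      × Lm (suc n) m (Qkm (suc n) zero j 0 m) x ≡ 0ℚ
      × Lm (suc n) m (Qkm (suc n) zero j 1 m) x ≡ 0ℚ
theorem7p1 n _ m j _ x inj =
  (λ k → Lm-Q inj (2 ℕ.+ k)) ,
  trans (Lm-Q inj 0) (ℚₚ.*-zeroˡ (eval x (Q 0))) ,
  trans (Lm-Q inj 1) (ℚₚ.*-zeroˡ (eval x (Q 0)))
  where open Integrand.Endpoints x m zero j
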